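{- Let $G_1,\ldots,G_n$ be pairwise disjoint connected graphs with chosen vertices $x_i\in V(G_i)$, and let $G$ be the circuit of these graphs with respect to $\{x_i\}_{i=1}^n$. Then $$Mo(G)\le \sum_{i=1}^{n}Mo(G_i)+\sum_{i=1}^{n}|E(G_i)|\,(|V(G)|-|V(G_i)|)+\begin{cases} n\sum_{i=1}^{t}\bigl||V(G_i)|-|V(G_{t+i})|\bigr| & \text{if } n=2t,\\ (n-1)|V(G)| & \text{if } n=2t-1.\end{cases}$$
   Context: Let $n\ge 3$ and let $C_n$ be the cycle with vertices $c_1,\ldots,c_n$ in cyclic order. The circuit of pairwise disjoint connected graphs $G_1,\ldots,G_n$ with respect to vertices $x_i\in V(G_i)$ is obtained from $C_n$ and the $G_i$ by identifying $x_i$ with $c_i$ for each $i$. For a graph $G$ and an edge $e=uv$, $n_u(e,G)$ denotes the number of vertices of $G$ strictly closer to $u$ than to $v$ (and $n_v(e,G)$ analogously). The Mostar index is $Mo(G)=\sum_{uv\in E(G)}|n_u(uv,G)-n_v(uv,G)|$. -}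

module Defs where

open import Data.Bool using (Bool; true; false; _∧_; _∨_; if_then_else_)
open import Data.Nat using (ℕ; zero; suc; _+_; _*_; _∸_; _≤_; _<_; _<ᵇ_; _≡ᵇ_; ∣_-_∣; _<?_)
open import Data.Fin using (Fin; toℕ; fromℕ<)
import Data.Fin as Fin
open import Data.List using (List; []; _∷_; map; _++_; length; filterᵇ; concatMap; allFin)
open import Data.Nat.ListAction using (sum)
open import Data.Bool.ListAction using (any)
open import Data.List.Membership.Propositional using (_∈_)
open import Data.List.Relation.Unary.Unique.Propositional using (Unique)
open import Data.Product using (Σ; _,_; _×_; proj₁; proj₂)
open import Relation.Binary.PropositionalEquality using (_≡_; refl)
open import Relation.Binary.Definitions using (DecidableEquality)
open import Relation.Nullary using (yes; no; does)

record Graph : Set₁ where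
  field
    Vertex   : Set
    _≟_      : DecidableEquality Vertex
    vertices : List Vertex
    adj      : Vertex → Vertex → Bool

open Graph public

record IsSimpleGraph (G : Graph) : Set where
  field
    complete : ∀ v → v ∈ vertices G
    unique   : Unique (vertices G)
    adj-sym  : ∀ u v → adj G u v ≡ adj G v u
    adj-irr  : ∀ v → adj G v v ≡ false

data Walk (G : Graph) : Vertex G → Vertex G → Set where
  [] : ∀ {u} → Walk G u u
  _∷_ : ∀ {u v w} → adj G u v ≡ true → Walk G v w → Walk G u w

Connected : Graph → Set
Connected G = ∀ u v → Walk G u v

∣V∣ : Graph → ℕ
∣V∣ G = length (vertices G)

eqᵇ : (G : Graph) → Vertex G → Vertex G → Bool
eqᵇ G u v = does (_≟_ G u v)

reach : (G : Graph) → ℕ → Vertex G → Vertex G → Bool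
reach G zero    u v = eqᵇ G u v
reach G (suc k) u v = eqᵇ G u v ∨ any (λ w → adj G u w ∧ reach G k w v) (vertices G)

-- least k in [start, start + fuel) with p k, or start + fuel if none
minFrom : (ℕ → Bool) → ℕ → ℕ → ℕ
minFrom p k zero    = k
minFrom p k (suc f) = if p k then k else minFrom p (suc k) f

-- shortest-path distance (the least length of a walk; walks of length
-- < |V| suffice in a connected graph)
dist : (G : Graph) → Vertex G → Vertex G → ℕ
dist G u v = minFrom (λ k → reach G k u v) 0 (∣V∣ G)

pairs : {A : Set} → List A → List (A × A)
pairs []       = []
pairs (x ∷ xs) = map (λ y → x , y) xs ++ pairs xs

edges : (G : Graph) → List (Vertex G × Vertex G)
edges G = filterᵇ (λ e → adj G (proj₁ e) (proj₂ e)) (pairs (vertices G))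

∣E∣ : Graph → ℕ
∣E∣ G = length (edges G)

nClose : (G : Graph) → Vertex G → Vertex G → ℕ
nClose G u v = length (filterᵇ (λ w → dist G w u <ᵇ dist G w v) (vertices G))

Mo : Graph → ℕ
Mo G = sum (map (λ e → ∣ nClose G (proj₁ e) (proj₂ e) - nClose G (proj₂ e) (proj₁ e) ∣) (edges G))

-- Circuit of graphs G_0, …, G_{n-1} w.r.t. x_i ∈ V(G_i)
-- (0-based indices; cycle C_n : c_0 c_1 … c_{n-1} c_0, c_i identified with x_i)

nextℕ : (n : ℕ) → Fin n → ℕ
nextℕ n i = if suc (toℕ i) ≡ᵇ n then 0 else suc (toℕ i)

cycAdj : (n : ℕ) → Fin n → Fin n → Bool
cycAdj n i j = (toℕ j ≡ᵇ nextℕ n i) ∨ (toℕ i ≡ᵇ nextℕ n j)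

circuitAdj : (n : ℕ) (G : Fin n → Graph) (x : (i : Fin n) → Vertex (G i)) →
             Σ (Fin n) (λ i → Vertex (G i)) → Σ (Fin n) (λ i → Vertex (G i)) → Bool
circuitAdj n G x (i , a) (j , b) with i Fin.≟ j
... | yes refl = adj (G i) a b
... | no _     = cycAdj n i j ∧ (eqᵇ (G i) a (x i) ∧ eqᵇ (G j) b (x j))

ΣDecEq : (n : ℕ) (G : Fin n → Graph) → DecidableEquality (Σ (Fin n) (λ i → Vertex (G i)))
ΣDecEq n G (i , a) (j , b) with i Fin.≟ j
... | no i≢j = no (λ { refl → i≢j refl })
ΣDecEq n G (i , a) (.i , b) | yes refl with _≟_ (G i) a b
... | yes refl = yes refl
... | no a≢b   = no (λ { refl → a≢b refl })

circuit : (n : ℕ) (G : Fin n → Graph) (x : (i : Fin n) → Vertex (G i)) → Graph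
circuit n G x = record
  { Vertex   = Σ (Fin n) (λ i → Vertex (G i))
  ; _≟_      = ΣDecEq n G
  ; vertices = concatMap (λ i → map (λ a → i , a) (vertices (G i))) (allFin n)
  ; adj      = circuitAdj n G x
  }

ΣFin : (n : ℕ) → (Fin n → ℕ) → ℕ
ΣFin n f = sum (map f (allFin n))

Σ< : ℕ → (ℕ → ℕ) → ℕ
Σ< zero    f = 0
Σ< (suc t) f = Σ< t f + f t

-- |V(G_k)| for a natural-number index k (0 if k ≥ n; never used then)
sizeAt : (n : ℕ) (G : Fin n → Graph) → ℕ → ℕ
sizeAt n G k with k <? n
... | yes k<n = ∣V∣ (G (fromℕ< k<n))
... | no _    = 0

-- Distances in the circuit decompose: from (k , c) to (i , a) with k ≠ i a shortest walk runs
-- from c to x_k in G_k, along the shorter arc of the cycle, and from x_i to a in G_i.  So for an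
-- edge ab of G_i every other block adds at most |V| − |V(G_i)| to |n_a − n_b|, while for a cycle
-- edge x_i x_{i+1} each block is wholly closer to one end, or equidistant, by its cyclic position.  For
-- n = 2t the blocks m and t + m are always on opposite sides, so every cycle edge contributes at
-- most Σ_{m<t} ||V(G_m)| − |V(G_{t+m})||.  For n = 2t − 1 the block opposite a cycle edge is
-- equidistant from its ends, and each block is opposite exactly one edge, so all cycle edges
-- together contribute at most n|V| − |V|.

module Submission where

open import Defs
open import Data.Bool using (Bool; true; false; _∧_; _∨_; not; if_then_else_)
open import Data.Bool.Properties using (T-≡; ¬-not; not-involutive; ∨-zeroʳ; ∨-comm; ∧-comm)
open import Data.Bool.ListAction using (any)
open import Data.Empty using (⊥-elim)
open import Data.Fin using (Fin; toℕ; fromℕ<) renaming (zero to fzero; suc to fsuc)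
import Data.Fin as Fin
import Data.Fin.Properties as Finₚ
open import Data.List using (List; []; _∷_; map; _++_; length; filterᵇ; concatMap; allFin)
open import Data.List.Properties using (map-tabulate; map-++; map-∘; length-tabulate)
open import Data.List.Membership.Propositional using (_∈_)
open import Data.List.Membership.Propositional.Properties using (∈-map⁺; ∈-concat⁺′; ∈-allFin)
import Data.List.Membership.DecPropositional as DecMembership
open import Data.List.Relation.Unary.All using ([]; _∷_)
import Data.List.Relation.Unary.All as All
open import Data.List.Relation.Unary.All.Properties using (¬Any⇒All¬)
open import Data.List.Relation.Unary.Any using (here; there)
open import Data.List.Relation.Unary.AllPairs using ([]; _∷_)
open import Data.List.Relation.Unary.Unique.Propositional using (Unique)
open import Data.List.Relation.Unary.Unique.Propositional.Properties using (allFin⁺)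
open import Data.Nat using (ℕ; zero; suc; _+_; _*_; _∸_; _≤_; _<_; _⊓_; z≤n; s≤s; _<ᵇ_; _≡ᵇ_; ∣_-_∣; _<?_; _≤?_; NonZero; >-nonZero; >-nonZero⁻¹; ≢-nonZero⁻¹)
open import Data.Nat.DivMod using (_%_; m%n<n; n%n≡0; m%n%n≡m%n; m<n⇒m%n≡m; [m+n]%n≡m%n; %-distribˡ-+)
open import Data.Nat.ListAction using (sum)
open import Data.Nat.Properties hiding (_≟_)
import Data.Nat.Properties as ℕₚ
open import Data.Nat.Solver using (module +-*-Solver)
open import Data.Product using (Σ; _,_; _×_; proj₁; proj₂)
open import Data.Sum using (_⊎_; inj₁; inj₂)
open import Function using (_∘_; id)
open import Function.Bundles using (Equivalence)
open import Relation.Binary.Definitions using (DecidableEquality)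
open import Relation.Binary.PropositionalEquality
open import Relation.Nullary using (¬_; yes; no; does)

open +-*-Solver
open Equivalence using (to; from)

<ᵇ-true : ∀ {a b} → a < b → (a <ᵇ b) ≡ true
<ᵇ-true lt = to T-≡ (<⇒<ᵇ lt)

<ᵇ-false : ∀ {a b} → b ≤ a → (a <ᵇ b) ≡ false
<ᵇ-false {a} {b} b≤a = ¬-not (λ e → <⇒≱ (<ᵇ⇒< a b (from T-≡ e)) b≤a)

≡ᵇ-true : ∀ {a b} → a ≡ b → (a ≡ᵇ b) ≡ true
≡ᵇ-true {a} {b} e = to T-≡ (≡⇒≡ᵇ a b e)

≡ᵇ-false : ∀ {a b} → ¬ a ≡ b → (a ≡ᵇ b) ≡ false
≡ᵇ-false {a} {b} a≢b = ¬-not (λ e → a≢b (≡ᵇ⇒≡ a b (from T-≡ e)))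

≡ᵇ-true⁻ : ∀ a b → (a ≡ᵇ b) ≡ true → a ≡ b
≡ᵇ-true⁻ a b e = ≡ᵇ⇒≡ a b (from T-≡ e)

∧-true⁻ : ∀ a b → (a ∧ b) ≡ true → a ≡ true × b ≡ true
∧-true⁻ true true _ = refl , refl

∨-true⁻ : ∀ a b → (a ∨ b) ≡ true → a ≡ true ⊎ b ≡ true
∨-true⁻ true  _ _ = inj₁ refl
∨-true⁻ false _ e = inj₂ e

module _ {A : Set} where

  any-true⁺ : (p : A → Bool) (xs : List A) {x : A} → x ∈ xs → p x ≡ true → any p xs ≡ true
  any-true⁺ p (y ∷ xs) (here refl) px rewrite px = refl
  any-true⁺ p (y ∷ xs) (there x∈xs) px rewrite any-true⁺ p xs x∈xs px = ∨-zeroʳ (p y)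

  any-true⁻ : (p : A → Bool) (xs : List A) → any p xs ≡ true → Σ A λ x → p x ≡ true
  any-true⁻ p (y ∷ xs) e with p y in py
  ... | true  = y , py
  ... | false = any-true⁻ p xs e

indicator : Bool → ℕ → ℕ
indicator b m = if b then m else 0

indicator≤ : ∀ b m → indicator b m ≤ m
indicator≤ true  m = ≤-refl
indicator≤ false m = z≤n

indicator-mono : ∀ b {m m′} → m ≤ m′ → indicator b m ≤ indicator b m′
indicator-mono true  m≤m′ = m≤m′
indicator-mono false _    = z≤n

+-<ᵇ-cancelˡ : ∀ a b c → (a + b <ᵇ a + c) ≡ (b <ᵇ c)
+-<ᵇ-cancelˡ zero    b c = refl
+-<ᵇ-cancelˡ (suc a) b c = +-<ᵇ-cancelˡ a b c

module _ {A : Set} where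

  sumOf : (A → ℕ) → List A → ℕ
  sumOf f xs = sum (map f xs)

  sumOf-++ : ∀ f xs ys → sumOf f (xs ++ ys) ≡ sumOf f xs + sumOf f ys
  sumOf-++ f []       ys = refl
  sumOf-++ f (x ∷ xs) ys = trans (cong (f x +_) (sumOf-++ f xs ys)) (sym (+-assoc (f x) _ _))

  sumOf-mono : ∀ {f g} xs → (∀ x → f x ≤ g x) → sumOf f xs ≤ sumOf g xs
  sumOf-mono []       f≤g = z≤n
  sumOf-mono (x ∷ xs) f≤g = +-mono-≤ (f≤g x) (sumOf-mono xs f≤g)

  sumOf-cong∈ : ∀ {f g} xs → (∀ x → x ∈ xs → f x ≡ g x) → sumOf f xs ≡ sumOf g xs
  sumOf-cong∈ []       f≗g = refl
  sumOf-cong∈ (x ∷ xs) f≗g = cong₂ _+_ (f≗g x (here refl)) (sumOf-cong∈ xs (λ y p → f≗g y (there p)))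

  sumOf-cong : ∀ {f g} xs → (∀ x → f x ≡ g x) → sumOf f xs ≡ sumOf g xs
  sumOf-cong xs f≗g = sumOf-cong∈ xs (λ x _ → f≗g x)

  sumOf-0 : ∀ xs → sumOf (λ _ → 0) xs ≡ 0
  sumOf-0 []       = refl
  sumOf-0 (x ∷ xs) = sumOf-0 xs

  sumOf-zero : ∀ {f} xs → (∀ x → x ∈ xs → f x ≡ 0) → sumOf f xs ≡ 0
  sumOf-zero xs f≡0 = trans (sumOf-cong∈ xs f≡0) (sumOf-0 xs)

  sumOf-+ : ∀ f g xs → sumOf (λ x → f x + g x) xs ≡ sumOf f xs + sumOf g xs
  sumOf-+ f g []       = refl
  sumOf-+ f g (x ∷ xs) rewrite sumOf-+ f g xs =
    solve 4 (λ a b c d → (a :+ b) :+ (c :+ d) := (a :+ c) :+ (b :+ d)) refl (f x) (g x) (sumOf f xs) (sumOf g xs)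

  sumOf-const : ∀ k xs → sumOf (λ _ → k) xs ≡ length xs * k
  sumOf-const k []       = refl
  sumOf-const k (x ∷ xs) = cong (k +_) (sumOf-const k xs)

  sumOf-indicator : ∀ b f xs → sumOf (λ x → indicator b (f x)) xs ≡ indicator b (sumOf f xs)
  sumOf-indicator true  f xs = refl
  sumOf-indicator false f xs = sumOf-0 xs

  sumOf-∈ : ∀ f {x} xs → x ∈ xs → f x ≤ sumOf f xs
  sumOf-∈ f (y ∷ xs) (here refl)  = m≤m+n (f y) _
  sumOf-∈ f (y ∷ xs) (there x∈xs) = ≤-trans (sumOf-∈ f xs x∈xs) (m≤n+m _ (f y))

  sumOf-filterᵇ : ∀ (p : A → Bool) f xs → sumOf f (filterᵇ p xs) ≡ sumOf (λ x → indicator (p x) (f x)) xs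
  sumOf-filterᵇ p f []       = refl
  sumOf-filterᵇ p f (x ∷ xs) with p x
  ... | true  = cong (f x +_) (sumOf-filterᵇ p f xs)
  ... | false = sumOf-filterᵇ p f xs

  length≡sumOf : ∀ (xs : List A) → length xs ≡ sumOf (λ _ → 1) xs
  length≡sumOf xs = sym (trans (sumOf-const 1 xs) (*-identityʳ _))

  length-filterᵇ : ∀ (p : A → Bool) xs → length (filterᵇ p xs) ≡ sumOf (λ x → indicator (p x) 1) xs
  length-filterᵇ p xs = trans (length≡sumOf (filterᵇ p xs)) (sumOf-filterᵇ p (λ _ → 1) xs)

  sumOf-indicator-const : ∀ (p : A → Bool) k xs → sumOf (λ x → indicator (p x) k) xs ≡ length (filterᵇ p xs) * k
  sumOf-indicator-const p k xs = trans (sym (sumOf-filterᵇ p (λ _ → k) xs)) (sumOf-const k (filterᵇ p xs))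

  sumOf-single≤ : (_≟_ : DecidableEquality A) (x : A) (k : ℕ) (xs : List A) → Unique xs →
                  sumOf (λ a → indicator (does (a ≟ x)) k) xs ≤ k
  sumOf-single≤ _≟_ x k []       _ = z≤n
  sumOf-single≤ _≟_ x k (a ∷ xs) (a∉xs ∷ u) with a ≟ x
  ... | no _     = sumOf-single≤ _≟_ x k xs u
  ... | yes refl = ≤-reflexive (trans (cong (k +_) (sumOf-zero xs none)) (+-identityʳ k))
    where
      none : ∀ b → b ∈ xs → indicator (does (b ≟ a)) k ≡ 0
      none b b∈xs with b ≟ a
      ... | yes refl = ⊥-elim (All.lookup a∉xs b∈xs refl)
      ... | no _     = refl

  sumOf-split : (_≟_ : DecidableEquality A) (f : A → ℕ) {x : A} (xs : List A) → Unique xs → x ∈ xs →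
                sumOf f xs ≡ f x + sumOf (λ a → if does (a ≟ x) then 0 else f a) xs
  sumOf-split _≟_ f {x} (y ∷ xs) (y∉xs ∷ u) (here refl) with y ≟ y
  ... | no y≢y = ⊥-elim (y≢y refl)
  ... | yes _  = cong (f y +_) (sumOf-cong∈ xs off-y)
    where
      off-y : ∀ a → a ∈ xs → f a ≡ (if does (a ≟ y) then 0 else f a)
      off-y a a∈xs with a ≟ y
      ... | yes refl = ⊥-elim (All.lookup y∉xs a∈xs refl)
      ... | no _     = refl
  sumOf-split _≟_ f {x} (y ∷ xs) (y∉xs ∷ u) (there x∈xs) with y ≟ x
  ... | yes refl = ⊥-elim (All.lookup y∉xs x∈xs refl)
  ... | no _     = begin
      f y + sumOf f xs            ≡⟨ cong (f y +_) (sumOf-split _≟_ f xs u x∈xs) ⟩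
      f y + (f x + sumOf g xs)    ≡⟨ solve 3 (λ a b c → a :+ (b :+ c) := b :+ (a :+ c)) refl (f y) (f x) (sumOf g xs) ⟩
      f x + (f y + sumOf g xs)    ∎
    where
      open ≡-Reasoning
      g : A → ℕ
      g a = if does (a ≟ x) then 0 else f a

module _ {A B : Set} where

  sumOf-map : ∀ (f : B → ℕ) (g : A → B) xs → sumOf f (map g xs) ≡ sumOf (f ∘ g) xs
  sumOf-map f g []       = refl
  sumOf-map f g (x ∷ xs) = cong (f (g x) +_) (sumOf-map f g xs)

  sumOf-concatMap : ∀ (f : B → ℕ) (h : A → List B) xs → sumOf f (concatMap h xs) ≡ sumOf (λ x → sumOf f (h x)) xs
  sumOf-concatMap f h []       = refl
  sumOf-concatMap f h (x ∷ xs) = trans (sumOf-++ f (h x) (concatMap h xs)) (cong (sumOf f (h x) +_) (sumOf-concatMap f h xs))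

  sumOf-swap : (h : A → B → ℕ) (xs : List A) (ys : List B) →
               sumOf (λ x → sumOf (h x) ys) xs ≡ sumOf (λ y → sumOf (λ x → h x y) xs) ys
  sumOf-swap h []       ys = sym (sumOf-0 ys)
  sumOf-swap h (x ∷ xs) ys =
    trans (cong (sumOf (h x) ys +_) (sumOf-swap h xs ys)) (sym (sumOf-+ (h x) (λ y → sumOf (λ x′ → h x′ y) xs) ys))

  pairs-map : ∀ (g : A → B) xs → pairs (map g xs) ≡ map (λ p → g (proj₁ p) , g (proj₂ p)) (pairs xs)
  pairs-map g []       = refl
  pairs-map g (x ∷ xs) =
    trans (cong₂ _++_ (trans (sym (map-∘ xs)) (map-∘ xs)) (pairs-map g xs))
          (sym (map-++ _ (map (x ,_) xs) (pairs xs)))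

module _ {A : Set} where

  sumOf-pairs-++ : ∀ (f : A × A → ℕ) xs ys →
    sumOf f (pairs (xs ++ ys)) ≡ sumOf f (pairs xs) + sumOf (λ a → sumOf (λ b → f (a , b)) ys) xs + sumOf f (pairs ys)
  sumOf-pairs-++ f []       ys = refl
  sumOf-pairs-++ f (x ∷ xs) ys = begin
      sumOf f (map (x ,_) (xs ++ ys) ++ pairs (xs ++ ys))
    ≡⟨ sumOf-++ f (map (x ,_) (xs ++ ys)) _ ⟩
      sumOf f (map (x ,_) (xs ++ ys)) + sumOf f (pairs (xs ++ ys))
    ≡⟨ cong₂ _+_ (trans (sumOf-map f (x ,_) (xs ++ ys)) (sumOf-++ (λ y → f (x , y)) xs ys)) (sumOf-pairs-++ f xs ys) ⟩
      (P + Q) + (R + S + U)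
    ≡⟨ solve 5 (λ P Q R S U → (P :+ Q) :+ (R :+ S :+ U) := (P :+ R) :+ (Q :+ S) :+ U) refl P Q R S U ⟩
      (P + R) + (Q + S) + U
    ≡⟨ cong (λ u → u + (Q + S) + U) (sym (trans (sumOf-++ f (map (x ,_) xs) (pairs xs)) (cong (_+ R) (sumOf-map f (x ,_) xs)))) ⟩
      sumOf f (pairs (x ∷ xs)) + (Q + S) + U
    ∎
    where
      open ≡-Reasoning
      P Q R S U : ℕ
      P = sumOf (λ y → f (x , y)) xs
      Q = sumOf (λ y → f (x , y)) ys
      R = sumOf f (pairs xs)
      S = sumOf (λ a → sumOf (λ b → f (a , b)) ys) xs
      U = sumOf f (pairs ys)

  sumOf-pairs-sym≤ : ∀ (h : A → A → ℕ) xs →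
    sumOf (λ p → h (proj₁ p) (proj₂ p) + h (proj₂ p) (proj₁ p)) (pairs xs) ≤ sumOf (λ a → sumOf (h a) xs) xs
  sumOf-pairs-sym≤ h []       = z≤n
  sumOf-pairs-sym≤ h (x ∷ xs) = begin
      sumOf g (map (x ,_) xs ++ pairs xs)
    ≡⟨ sumOf-++ g (map (x ,_) xs) (pairs xs) ⟩
      sumOf g (map (x ,_) xs) + sumOf g (pairs xs)
    ≡⟨ cong (_+ sumOf g (pairs xs)) (trans (sumOf-map g (x ,_) xs) (sumOf-+ (h x) (λ y → h y x) xs)) ⟩
      (sumOf (h x) xs + sumOf (λ y → h y x) xs) + sumOf g (pairs xs)
    ≤⟨ +-monoʳ-≤ (sumOf (h x) xs + sumOf (λ y → h y x) xs) (sumOf-pairs-sym≤ h xs) ⟩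
      (sumOf (h x) xs + sumOf (λ y → h y x) xs) + sumOf (λ a → sumOf (h a) xs) xs
    ≡⟨ +-assoc (sumOf (h x) xs) _ _ ⟩
      sumOf (h x) xs + (sumOf (λ y → h y x) xs + sumOf (λ a → sumOf (h a) xs) xs)
    ≡⟨ cong (sumOf (h x) xs +_) (sym (sumOf-+ (λ y → h y x) (λ a → sumOf (h a) xs) xs)) ⟩
      sumOf (h x) xs + sumOf (λ a → h a x + sumOf (h a) xs) xs
    ≤⟨ m≤n+m _ (h x x) ⟩
      h x x + (sumOf (h x) xs + sumOf (λ a → h a x + sumOf (h a) xs) xs)
    ≡⟨ sym (+-assoc (h x x) _ _) ⟩
      sumOf (h x) (x ∷ xs) + sumOf (λ a → sumOf (h a) (x ∷ xs)) xs
    ∎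
    where
      open ≤-Reasoning
      g : A × A → ℕ
      g (a , b) = h a b + h b a

module _ {I : Set} {P : I → Set} where

  blocks : ((i : I) → List (P i)) → List I → List (Σ I P)
  blocks xs = concatMap (λ i → map (i ,_) (xs i))

  sumOf-blocks : ∀ (f : Σ I P → ℕ) xs is → sumOf f (blocks xs is) ≡ sumOf (λ i → sumOf (λ a → f (i , a)) (xs i)) is
  sumOf-blocks f xs is = trans (sumOf-concatMap f _ is) (sumOf-cong is (λ i → sumOf-map f (i ,_) (xs i)))

  sumOf-pairs-blocks : ∀ (f : Σ I P × Σ I P → ℕ) xs is → Unique is →
    (∀ {i j} a b → ¬ i ≡ j → f ((i , a) , (j , b)) ≡ 0) →
    sumOf f (pairs (blocks xs is)) ≡ sumOf (λ i → sumOf (λ p → f ((i , proj₁ p) , (i , proj₂ p))) (pairs (xs i))) is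
  sumOf-pairs-blocks f xs []       _            _     = refl
  sumOf-pairs-blocks f xs (i ∷ is) (i∉is ∷ uis) f-off = begin
      sumOf f (pairs (Bᵢ ++ blocks xs is))
    ≡⟨ sumOf-pairs-++ f Bᵢ (blocks xs is) ⟩
      sumOf f (pairs Bᵢ) + sumOf (λ a → sumOf (λ b → f (a , b)) (blocks xs is)) Bᵢ + sumOf f (pairs (blocks xs is))
    ≡⟨ cong₂ (λ u v → sumOf f (pairs Bᵢ) + u + v) no-cross (sumOf-pairs-blocks f xs is uis f-off) ⟩
      sumOf f (pairs Bᵢ) + 0 + rest
    ≡⟨ cong (_+ rest) (trans (+-identityʳ _) (trans (cong (sumOf f) (pairs-map (i ,_) (xs i))) (sumOf-map f _ (pairs (xs i))))) ⟩
      sumOf (λ p → f ((i , proj₁ p) , (i , proj₂ p))) (pairs (xs i)) + rest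
    ∎
    where
      open ≡-Reasoning
      Bᵢ : List (Σ I P)
      Bᵢ = map (i ,_) (xs i)
      rest : ℕ
      rest = sumOf (λ j → sumOf (λ p → f ((j , proj₁ p) , (j , proj₂ p))) (pairs (xs j))) is
      no-cross : sumOf (λ a → sumOf (λ b → f (a , b)) (blocks xs is)) Bᵢ ≡ 0
      no-cross = trans (sumOf-map (λ a → sumOf (λ b → f (a , b)) (blocks xs is)) (i ,_) (xs i)) (sumOf-zero (xs i) (λ a _ →
        trans (sumOf-blocks (λ b → f ((i , a) , b)) xs is) (sumOf-zero is (λ j j∈is →
          sumOf-zero (xs j) (λ b _ → f-off a b (All.lookup i∉is j∈is))))))

ΣFin-suc : ∀ n (f : Fin (suc n) → ℕ) → ΣFin (suc n) f ≡ f fzero + ΣFin n (f ∘ fsuc)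
ΣFin-suc n f = cong (λ xs → f fzero + sum xs) (trans (map-tabulate fsuc f) (sym (map-tabulate id (f ∘ fsuc))))

ΣFin-cong : ∀ n {f g : Fin n → ℕ} → (∀ k → f k ≡ g k) → ΣFin n f ≡ ΣFin n g
ΣFin-cong n = sumOf-cong (allFin n)

ΣFin-mono : ∀ n {f g : Fin n → ℕ} → (∀ k → f k ≤ g k) → ΣFin n f ≤ ΣFin n g
ΣFin-mono n = sumOf-mono (allFin n)

ΣFin-+ : ∀ n (f g : Fin n → ℕ) → ΣFin n (λ k → f k + g k) ≡ ΣFin n f + ΣFin n g
ΣFin-+ n f g = sumOf-+ f g (allFin n)

ΣFin-const : ∀ n m → ΣFin n (λ _ → m) ≡ n * m
ΣFin-const n m = trans (sumOf-const m (allFin n)) (cong (_* m) (length-tabulate {n = n} id))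

ΣFin-swap : ∀ n m (h : Fin n → Fin m → ℕ) → ΣFin n (λ i → ΣFin m (h i)) ≡ ΣFin m (λ j → ΣFin n (λ i → h i j))
ΣFin-swap n m h = sumOf-swap h (allFin n) (allFin m)

ΣFin-single : ∀ n (f : Fin n → ℕ) i → f i ≤ ΣFin n f
ΣFin-single n f i = sumOf-∈ f (allFin n) (∈-allFin i)

Σ<-suc : ∀ n (f : ℕ → ℕ) → Σ< (suc n) f ≡ f 0 + Σ< n (f ∘ suc)
Σ<-suc zero    f = +-comm 0 (f 0)
Σ<-suc (suc n) f rewrite Σ<-suc n f = +-assoc (f 0) _ _

ΣFin-split : ∀ n (f : Fin n → ℕ) i → ΣFin n f ≡ f i + ΣFin n (λ k → if does (k Fin.≟ i) then 0 else f k)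
ΣFin-split n f i = sumOf-split Fin._≟_ f (allFin n) (allFin⁺ n) (∈-allFin i)

ΣFin-toℕ : ∀ n (f : ℕ → ℕ) → ΣFin n (f ∘ toℕ) ≡ Σ< n f
ΣFin-toℕ zero    f = refl
ΣFin-toℕ (suc n) f = begin
    ΣFin (suc n) (f ∘ toℕ)       ≡⟨ ΣFin-suc n (f ∘ toℕ) ⟩
    f 0 + ΣFin n (f ∘ suc ∘ toℕ) ≡⟨ cong (f 0 +_) (ΣFin-toℕ n (f ∘ suc)) ⟩
    f 0 + Σ< n (f ∘ suc)         ≡⟨ sym (Σ<-suc n f) ⟩
    Σ< (suc n) f                 ∎
  where open ≡-Reasoning

ΣFin-indicator≤ : ∀ n m k → ΣFin n (λ j → indicator (toℕ j ≡ᵇ m) k) ≤ k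
ΣFin-indicator≤ zero    m       k = z≤n
ΣFin-indicator≤ (suc n) zero    k rewrite ΣFin-suc n (λ j → indicator (toℕ j ≡ᵇ 0) k) =
  ≤-reflexive (trans (cong (k +_) (sumOf-0 (allFin n))) (+-identityʳ k))
ΣFin-indicator≤ (suc n) (suc m) k rewrite ΣFin-suc n (λ j → indicator (toℕ j ≡ᵇ suc m) k) =
  ΣFin-indicator≤ n m k

Σ<-+ : ∀ n (f g : ℕ → ℕ) → Σ< n (λ k → f k + g k) ≡ Σ< n f + Σ< n g
Σ<-+ zero    f g = refl
Σ<-+ (suc n) f g rewrite Σ<-+ n f g =
  solve 4 (λ a b c d → (a :+ b) :+ (c :+ d) := (a :+ c) :+ (b :+ d)) refl (Σ< n f) (Σ< n g) (f n) (g n)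

Σ<-+-split : ∀ a b (f : ℕ → ℕ) → Σ< (a + b) f ≡ Σ< a f + Σ< b (λ m → f (a + m))
Σ<-+-split a zero    f rewrite +-identityʳ a = sym (+-identityʳ _)
Σ<-+-split a (suc b) f rewrite +-suc a b | Σ<-+-split a b f = +-assoc (Σ< a f) _ _

Σ<-cong : ∀ n {f g : ℕ → ℕ} → (∀ k → k < n → f k ≡ g k) → Σ< n f ≡ Σ< n g
Σ<-cong zero    f≗g = refl
Σ<-cong (suc n) f≗g = cong₂ _+_ (Σ<-cong n (λ k k<n → f≗g k (m≤n⇒m≤1+n k<n))) (f≗g n ≤-refl)

∣m+n-o+p∣≤∣m-o∣+∣n-p∣ : ∀ m n o p → ∣ m + n - o + p ∣ ≤ ∣ m - o ∣ + ∣ n - p ∣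
∣m+n-o+p∣≤∣m-o∣+∣n-p∣ m n o p = begin
    ∣ m + n - o + p ∣                   ≤⟨ ∣-∣-triangle (m + n) (o + n) (o + p) ⟩
    ∣ m + n - o + n ∣ + ∣ o + n - o + p ∣ ≡⟨ cong₂ _+_ (cong₂ ∣_-_∣ (+-comm m n) (+-comm o n)) refl ⟩
    ∣ n + m - n + o ∣ + ∣ o + n - o + p ∣ ≡⟨ cong₂ _+_ (∣m+n-m+o∣≡∣n-o∣ n m o) (∣m+n-m+o∣≡∣n-o∣ o n p) ⟩
    ∣ m - o ∣ + ∣ n - p ∣                 ∎
  where open ≤-Reasoning

∣m-n∣≤m+n : ∀ m n → ∣ m - n ∣ ≤ m + n
∣m-n∣≤m+n m n = ≤-trans (∣m-n∣≤m⊔n m n) (m⊔n≤m+n m n)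

∣m-n∣≤o : ∀ {m n o} → m ≤ o → n ≤ o → ∣ m - n ∣ ≤ o
∣m-n∣≤o {m} {n} m≤o n≤o = ≤-trans (∣m-n∣≤m⊔n m n) (⊔-lub m≤o n≤o)

Σ<-∣-∣ : ∀ n (f g : ℕ → ℕ) → ∣ Σ< n f - Σ< n g ∣ ≤ Σ< n (λ k → ∣ f k - g k ∣)
Σ<-∣-∣ zero    f g = z≤n
Σ<-∣-∣ (suc n) f g = ≤-trans (∣m+n-o+p∣≤∣m-o∣+∣n-p∣ (Σ< n f) (f n) (Σ< n g) (g n)) (+-monoˡ-≤ _ (Σ<-∣-∣ n f g))

-- Walks and shortest-path distance

module _ {A : Set} where

  remove : (ys : List A) {x : A} → x ∈ ys → List A
  remove (y ∷ ys) (here _)  = ys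
  remove (y ∷ ys) (there p) = y ∷ remove ys p

  length-remove : (ys : List A) {x : A} (p : x ∈ ys) → length ys ≡ suc (length (remove ys p))
  length-remove (y ∷ ys) (here _)  = refl
  length-remove (y ∷ ys) (there p) = cong suc (length-remove ys p)

  ∈-remove : (ys : List A) {x z : A} (p : x ∈ ys) → z ∈ ys → ¬ z ≡ x → z ∈ remove ys p
  ∈-remove (y ∷ ys) (here refl) (here refl) z≢x = ⊥-elim (z≢x refl)
  ∈-remove (y ∷ ys) (here refl) (there q)   z≢x = q
  ∈-remove (y ∷ ys) (there p)   (here refl) z≢x = here refl
  ∈-remove (y ∷ ys) (there p)   (there q)   z≢x = there (∈-remove ys p q z≢x)

  Unique⇒length≤ : (xs ys : List A) → Unique xs → (∀ {z} → z ∈ xs → z ∈ ys) → length xs ≤ length ys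
  Unique⇒length≤ []       ys _          _   = z≤n
  Unique⇒length≤ (x ∷ xs) ys (x∉xs ∷ u) xs⊆ys =
    subst (suc (length xs) ≤_) (sym (length-remove ys x∈ys))
      (s≤s (Unique⇒length≤ xs (remove ys x∈ys) u
              (λ z∈xs → ∈-remove ys x∈ys (xs⊆ys (there z∈xs)) (λ { refl → All.lookup x∉xs z∈xs refl }))))
    where
      x∈ys : x ∈ ys
      x∈ys = xs⊆ys (here refl)

minFrom-least : ∀ (p : ℕ → Bool) s f k → p k ≡ true → s ≤ k → k < s + f →
                minFrom p s f ≤ k × p (minFrom p s f) ≡ true
minFrom-least p s zero    k pk s≤k k<s = ⊥-elim (<⇒≱ k<s (subst (_≤ k) (sym (+-identityʳ s)) s≤k))
minFrom-least p s (suc f) k pk s≤k k<s with p s in ps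
... | true  = s≤k , ps
... | false with m≤n⇒m<n∨m≡n s≤k
...   | inj₁ s<k  = minFrom-least p (suc s) f k pk s<k (subst (k <_) (+-suc s f) k<s)
...   | inj₂ refl with trans (sym ps) pk
...     | ()

module Walks (G : Graph) (complete : ∀ v → v ∈ vertices G) where

  open DecMembership (_≟_ G) using (_∈?_)

  len : ∀ {u v} → Walk G u v → ℕ
  len []      = 0
  len (e ∷ w) = suc (len w)

  infixr 5 _++ʷ_
  _++ʷ_ : ∀ {u v w} → Walk G u v → Walk G v w → Walk G u w
  []      ++ʷ q = q
  (e ∷ p) ++ʷ q = e ∷ (p ++ʷ q)

  len-++ʷ : ∀ {u v w} (p : Walk G u v) (q : Walk G v w) → len (p ++ʷ q) ≡ len p + len q
  len-++ʷ []      q = refl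
  len-++ʷ (e ∷ p) q = cong suc (len-++ʷ p q)

  snoc : ∀ {u v w} → Walk G u v → adj G v w ≡ true → Walk G u w
  snoc p e = p ++ʷ (e ∷ [])

  len-snoc : ∀ {u v w} (p : Walk G u v) (e : adj G v w ≡ true) → len (snoc p e) ≡ suc (len p)
  len-snoc p e = trans (len-++ʷ p (e ∷ [])) (+-comm (len p) 1)

  reverse : (∀ u v → adj G u v ≡ adj G v u) → ∀ {u v} → Walk G u v → Walk G v u
  reverse sym-adj []                  = []
  reverse sym-adj (_∷_ {u} {m} e w) = snoc (reverse sym-adj w) (trans (sym-adj m u) e)

  len-reverse : ∀ sym-adj {u v} (w : Walk G u v) → len (reverse sym-adj w) ≡ len w
  len-reverse sym-adj []      = refl
  len-reverse sym-adj (e ∷ w) = trans (len-snoc (reverse sym-adj w) _) (cong suc (len-reverse sym-adj w))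

  support : ∀ {u v} → Walk G u v → List (Vertex G)
  support {u} []      = u ∷ []
  support {u} (e ∷ w) = u ∷ support w

  length-support : ∀ {u v} (w : Walk G u v) → length (support w) ≡ suc (len w)
  length-support []      = refl
  length-support (e ∷ w) = cong suc (length-support w)

  Path : Vertex G → Vertex G → Set
  Path u v = Σ (Walk G u v) (Unique ∘ support)

  suffix : ∀ {u v z} (w : Walk G v z) → u ∈ support w → Unique (support w) →
           Σ (Path u z) λ p → len (proj₁ p) ≤ len w
  suffix []      (here refl) U           = ([] , U) , z≤n
  suffix (e ∷ w) (here refl) U           = (e ∷ w , U) , ≤-refl
  suffix (e ∷ w) (there u∈w) (_ ∷ U) with suffix w u∈w U
  ... | p , p≤w = p , m≤n⇒m≤1+n p≤w

  walk⇒path : ∀ {u v} (w : Walk G u v) → Σ (Path u v) λ p → len (proj₁ p) ≤ len w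
  walk⇒path []          = ([] , [] ∷ []) , z≤n
  walk⇒path {u} (e ∷ r) with walk⇒path r
  ... | (r′ , U) , r′≤r with u ∈? support r′
  ...   | no u∉r′  = (e ∷ r′ , ¬Any⇒All¬ (support r′) u∉r′ ∷ U) , s≤s r′≤r
  ...   | yes u∈r′ with suffix r′ u∈r′ U
  ...     | p , p≤r′ = p , m≤n⇒m≤1+n (≤-trans p≤r′ r′≤r)

  len-path< : ∀ {u v} (p : Path u v) → len (proj₁ p) < ∣V∣ G
  len-path< (w , U) = subst (_≤ ∣V∣ G) (length-support w) (Unique⇒length≤ (support w) (vertices G) U (λ {z} _ → complete z))

  eqᵇ-refl : ∀ u → eqᵇ G u u ≡ true
  eqᵇ-refl u with _≟_ G u u
  ... | yes _ = refl
  ... | no u≢u = ⊥-elim (u≢u refl)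

  eqᵇ⇒≡ : ∀ u v → eqᵇ G u v ≡ true → u ≡ v
  eqᵇ⇒≡ u v e with _≟_ G u v
  ... | yes u≡v = u≡v

  walk⇒reach : ∀ {u v} (w : Walk G u v) k → len w ≤ k → reach G k u v ≡ true
  walk⇒reach {u} []      zero    _ = eqᵇ-refl u
  walk⇒reach {u} []      (suc k) _ rewrite eqᵇ-refl u = refl
  walk⇒reach {u} {v} (_∷_ {v = m} e w) (suc k) (s≤s w≤k) =
    trans (cong (eqᵇ G u v ∨_) (any-true⁺ (λ z → adj G u z ∧ reach G k z v) (vertices G) (complete m) step))
          (∨-zeroʳ (eqᵇ G u v))
    where
      step : (adj G u m ∧ reach G k m v) ≡ true
      step = trans (cong (_∧ reach G k m v) e) (walk⇒reach w k w≤k)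

  reach⇒walk : ∀ k u v → reach G k u v ≡ true → Σ (Walk G u v) λ w → len w ≤ k
  reach⇒walk zero u v e with eqᵇ⇒≡ u v e
  ... | refl = [] , z≤n
  reach⇒walk (suc k) u v e with ∨-true⁻ (eqᵇ G u v) _ e
  ... | inj₁ u≡ᵇv with eqᵇ⇒≡ u v u≡ᵇv
  ...   | refl = [] , z≤n
  reach⇒walk (suc k) u v e | inj₂ step with any-true⁻ _ (vertices G) step
  ... | m , um with ∧-true⁻ (adj G u m) _ um
  ...   | a , r with reach⇒walk k m v r
  ...     | w , w≤k = a ∷ w , s≤s w≤k

  -- dist is a bounded search; it is exact because some shortest walk is a path, of length < |V|.
  dist-minimal : ∀ {u v} (w : Walk G u v) → dist G u v ≤ len w × reach G (dist G u v) u v ≡ true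
  dist-minimal {u} {v} w with walk⇒path w
  ... | p , p≤w with minFrom-least (λ k → reach G k u v) 0 (∣V∣ G) (len (proj₁ p))
                       (walk⇒reach (proj₁ p) _ ≤-refl) z≤n (len-path< p)
  ...   | d≤p , reach-d = ≤-trans d≤p p≤w , reach-d

  dist≤len : ∀ {u v} (w : Walk G u v) → dist G u v ≤ len w
  dist≤len w = proj₁ (dist-minimal w)

  geodesic : ∀ {u v} → Walk G u v → Σ (Walk G u v) λ w → len w ≡ dist G u v
  geodesic w with reach⇒walk _ _ _ (proj₂ (dist-minimal w))
  ... | w′ , w′≤d = w′ , ≤-antisym w′≤d (dist≤len w′)

  dist≡ : ∀ {u v} (w : Walk G u v) d → len w ≡ d → (∀ (w′ : Walk G u v) → d ≤ len w′) → dist G u v ≡ d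
  dist≡ w d w≡d d≤ with geodesic w
  ... | w₀ , w₀≡dist = ≤-antisym (subst (dist G _ _ ≤_) w≡d (dist≤len w)) (subst (d ≤_) w₀≡dist (d≤ w₀))

  dist-refl : ∀ u → dist G u u ≡ 0
  dist-refl u = n≤0⇒n≡0 (dist≤len {u} {u} [])

  dist-adj≤ : Connected G → ∀ a b t → adj G a b ≡ true → dist G a t ≤ suc (dist G b t)
  dist-adj≤ conn a b t e with geodesic (conn b t)
  ... | w , w≡d = subst (dist G a t ≤_) (cong suc w≡d) (dist≤len (e ∷ w))

  potential≤len : (φ : Vertex G → ℕ) → (∀ a b → adj G a b ≡ true → φ a ≤ suc (φ b)) →
                  ∀ {u t} (w : Walk G u t) → φ u ≤ len w + φ t
  potential≤len φ φ-lip []                  = ≤-refl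
  potential≤len φ φ-lip {u} (_∷_ {v = m} e w) = ≤-trans (φ-lip u m e) (s≤s (potential≤len φ φ-lip w))

-- Positions on a cycle of length n

-- offset a b is the number of forward steps from position a to position b, and around d is
-- the length of the shorter of the two arcs spanned by an offset d.
module Cyclic (n : ℕ) .{{_ : NonZero n}} where

  next : ℕ → ℕ
  next d = if suc d ≡ᵇ n then 0 else suc d

  offset : ℕ → ℕ → ℕ
  offset a b = (b + (n ∸ a)) % n

  around : ℕ → ℕ
  around d = d ⊓ (n ∸ d)

  cycDist : ℕ → ℕ → ℕ
  cycDist a b = around (offset a b)

  next-cases : ∀ d → (suc d ≡ n × next d ≡ 0) ⊎ (¬ suc d ≡ n × next d ≡ suc d)
  next-cases d with suc d ℕₚ.≟ n
  ... | yes e   = inj₁ (e , cong (λ b → if b then 0 else suc d) (≡ᵇ-true e))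
  ... | no  d+1≢n = inj₂ (d+1≢n , cong (λ b → if b then 0 else suc d) (≡ᵇ-false d+1≢n))

  next≡suc%n : ∀ d → d < n → next d ≡ suc d % n
  next≡suc%n d d<n with next-cases d
  ... | inj₁ (e , nd≡0)      = trans nd≡0 (sym (trans (cong (_% n) e) (n%n≡0 n)))
  ... | inj₂ (d+1≢n , nd≡d+1) = trans nd≡d+1 (sym (m<n⇒m%n≡m (≤∧≢⇒< d<n d+1≢n)))

  next<n : ∀ d → d < n → next d < n
  next<n d d<n rewrite next≡suc%n d d<n = m%n<n (suc d) n

  [m%n+k]%n≡[m+k]%n : ∀ m k → (m % n + k) % n ≡ (m + k) % n
  [m%n+k]%n≡[m+k]%n m k = begin
    (m % n + k) % n           ≡⟨ %-distribˡ-+ (m % n) k n ⟩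
    (m % n % n + k % n) % n   ≡⟨ cong (λ z → (z + k % n) % n) (m%n%n≡m%n m n) ⟩
    (m % n + k % n) % n       ≡⟨ %-distribˡ-+ m k n ⟨
    (m + k) % n               ∎ where open ≡-Reasoning

  [m+k%n]%n≡[m+k]%n : ∀ m k → (m + k % n) % n ≡ (m + k) % n
  [m+k%n]%n≡[m+k]%n m k =
    trans (cong (_% n) (+-comm m (k % n))) (trans ([m%n+k]%n≡[m+k]%n k m) (cong (_% n) (+-comm k m)))

  offset<n : ∀ a b → offset a b < n
  offset<n a b = m%n<n _ n

  offset-refl : ∀ a → a ≤ n → offset a a ≡ 0
  offset-refl a a≤n = trans (cong (_% n) (m+[n∸m]≡n a≤n)) (n%n≡0 n)

  offset-next : ∀ a b → b < n → offset a (next b) ≡ next (offset a b)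
  offset-next a b b<n = begin
    (next b + (n ∸ a)) % n     ≡⟨ cong (λ z → (z + (n ∸ a)) % n) (next≡suc%n b b<n) ⟩
    (suc b % n + (n ∸ a)) % n  ≡⟨ [m%n+k]%n≡[m+k]%n (suc b) (n ∸ a) ⟩
    suc (b + (n ∸ a)) % n      ≡⟨ [m+k%n]%n≡[m+k]%n 1 (b + (n ∸ a)) ⟨
    suc (offset a b) % n       ≡⟨ next≡suc%n (offset a b) (offset<n a b) ⟨
    next (offset a b)          ∎ where open ≡-Reasoning

  [offset+a]%n≡b : ∀ a b → a ≤ n → b < n → (offset a b + a) % n ≡ b
  [offset+a]%n≡b a b a≤n b<n = begin
    ((b + (n ∸ a)) % n + a) % n ≡⟨ [m%n+k]%n≡[m+k]%n (b + (n ∸ a)) a ⟩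
    (b + (n ∸ a) + a) % n       ≡⟨ cong (_% n) (+-assoc b (n ∸ a) a) ⟩
    (b + ((n ∸ a) + a)) % n     ≡⟨ cong (λ z → (b + z) % n) (m∸n+n≡m a≤n) ⟩
    (b + n) % n                 ≡⟨ [m+n]%n≡m%n b n ⟩
    b % n                       ≡⟨ m<n⇒m%n≡m b<n ⟩
    b                           ∎ where open ≡-Reasoning

  offset-injective : ∀ a {b b′} → a ≤ n → b < n → b′ < n → offset a b ≡ offset a b′ → b ≡ b′
  offset-injective a {b} {b′} a≤n b<n b′<n e =
    trans (sym ([offset+a]%n≡b a b a≤n b<n)) (trans (cong (λ z → (z + a) % n) e) ([offset+a]%n≡b a b′ a≤n b′<n))

  [d+e]%n≡0 : ∀ d e → d < n → e < n → (d + e) % n ≡ 0 → d + e ≡ 0 ⊎ d + e ≡ n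
  [d+e]%n≡0 d e d<n e<n z with d + e <? n
  ... | yes d+e<n = inj₁ (trans (sym (m<n⇒m%n≡m d+e<n)) z)
  ... | no  d+e≮n = inj₂ (begin
      d + e             ≡⟨ m∸n+n≡m n≤d+e ⟨
      (d + e ∸ n) + n   ≡⟨ cong (_+ n) d+e∸n≡0 ⟩
      n                 ∎)
    where
      open ≡-Reasoning
      n≤d+e : n ≤ d + e
      n≤d+e = ≮⇒≥ d+e≮n
      d+e∸n<n : d + e ∸ n < n
      d+e∸n<n = +-cancelʳ-< n (d + e ∸ n) n (subst (_< n + n) (sym (m∸n+n≡m n≤d+e)) (+-mono-< d<n e<n))
      d+e∸n≡0 : d + e ∸ n ≡ 0
      d+e∸n≡0 = trans (sym (m<n⇒m%n≡m d+e∸n<n))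
                  (trans (sym ([m+n]%n≡m%n (d + e ∸ n) n)) (trans (cong (_% n) (m∸n+n≡m n≤d+e)) z))

  [offset+offset]%n≡0 : ∀ a b → a ≤ n → b ≤ n → (offset a b + offset b a) % n ≡ 0
  [offset+offset]%n≡0 a b a≤n b≤n = begin
    ((b + (n ∸ a)) % n + (a + (n ∸ b)) % n) % n ≡⟨ [m%n+k]%n≡[m+k]%n (b + (n ∸ a)) _ ⟩
    ((b + (n ∸ a)) + (a + (n ∸ b)) % n) % n     ≡⟨ [m+k%n]%n≡[m+k]%n (b + (n ∸ a)) _ ⟩
    ((b + (n ∸ a)) + (a + (n ∸ b))) % n         ≡⟨ cong (_% n) (swap-inner b (n ∸ a) a (n ∸ b)) ⟩
    ((b + (n ∸ b)) + (a + (n ∸ a))) % n         ≡⟨ cong₂ (λ u v → (u + v) % n) (m+[n∸m]≡n b≤n) (m+[n∸m]≡n a≤n) ⟩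
    (n + n) % n                                 ≡⟨ [m+n]%n≡m%n n n ⟩
    n % n                                       ≡⟨ n%n≡0 n ⟩
    0                                           ∎
    where
      open ≡-Reasoning
      swap-inner : ∀ p q r s → (p + q) + (r + s) ≡ (p + s) + (r + q)
      swap-inner = solve 4 (λ p q r s → (p :+ q) :+ (r :+ s) := (p :+ s) :+ (r :+ q)) refl

  offset+offset : ∀ a b → a ≤ n → b ≤ n → offset a b + offset b a ≡ 0 ⊎ offset a b + offset b a ≡ n
  offset+offset a b a≤n b≤n = [d+e]%n≡0 _ _ (offset<n a b) (offset<n b a) ([offset+offset]%n≡0 a b a≤n b≤n)

  around-flip : ∀ d → d ≤ n → around (n ∸ d) ≡ around d
  around-flip d d≤n = trans (cong ((n ∸ d) ⊓_) (m∸[m∸n]≡n d≤n)) (⊓-comm (n ∸ d) d)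

  cycDist-sym : ∀ a b → a ≤ n → b ≤ n → cycDist a b ≡ cycDist b a
  cycDist-sym a b a≤n b≤n with offset+offset a b a≤n b≤n
  ... | inj₁ z = cong around (trans (m+n≡0⇒m≡0 _ z) (sym (m+n≡0⇒n≡0 _ z)))
  ... | inj₂ e = trans (sym (around-flip (offset a b) (<⇒≤ (offset<n a b))))
                       (cong around (trans (cong (_∸ offset a b) (sym e)) (m+n∸m≡n (offset a b) (offset b a))))

  n∸d≡1 : ∀ d → suc d ≡ n → n ∸ d ≡ 1
  n∸d≡1 d e = trans (cong (_∸ d) (sym e)) (trans (cong (_∸ d) (+-comm 1 d)) (m+n∸m≡n d 1))

  around-next≤ : ∀ d → d < n → around (next d) ≤ suc (around d)
  around-next≤ d d<n with next-cases d
  ... | inj₁ (_ , nd≡0)  rewrite nd≡0  = z≤n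
  ... | inj₂ (_ , nd≡d+1) rewrite nd≡d+1 =
    ⊓-mono-≤ (≤-refl {suc d}) (≤-trans (∸-monoʳ-≤ n (n≤1+n d)) (n≤1+n (n ∸ d)))

  around≤next : ∀ d → d < n → around d ≤ suc (around (next d))
  around≤next d d<n with next-cases d
  ... | inj₁ (e , nd≡0)  rewrite nd≡0  = subst (around d ≤_) (n∸d≡1 d e) (m⊓n≤n d (n ∸ d))
  ... | inj₂ (_ , nd≡d+1) rewrite nd≡d+1 =
    ⊓-mono-≤ (≤-trans (n≤1+n d) (n≤1+n (suc d))) (≤-reflexive (+-∸-assoc 1 d<n))

  -- On an even cycle n = t + t, the step from offset d to d + 1 moves towards a block iff d < t.
  module EvenCycle (t : ℕ) (n≡t+t : n ≡ t + t) where

    1≤t : 1 ≤ t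
    1≤t = positive t n≡t+t
      where
        positive : ∀ u → n ≡ u + u → 1 ≤ u
        positive zero    n≡0 = ⊥-elim (≢-nonZero⁻¹ n n≡0)
        positive (suc u) _   = s≤s z≤n

    around-small : ∀ d → d + d ≤ n → around d ≡ d
    around-small d d+d≤n = m≤n⇒m⊓n≡m (m+n≤o⇒m≤o∸n d d+d≤n)

    around-large : ∀ d → n ≤ d + d → around d ≡ n ∸ d
    around-large d n≤d+d = m≥n⇒m⊓n≡n (m≤n+o⇒m∸n≤o n d n≤d+d)

    around-next-comparison : ∀ d → d < n →
      (around d <ᵇ around (next d)) ≡ (d <ᵇ t) × (around (next d) <ᵇ around d) ≡ not (d <ᵇ t)
    around-next-comparison d d<n with next-cases d
    ... | inj₁ (e , nd≡0) rewrite nd≡0 =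
      trans (<ᵇ-false {around d} {0} z≤n) (sym d≮t) , trans (<ᵇ-true (subst (0 <_) (sym around-d≡1) (s≤s z≤n))) (cong not (sym d≮t))
      where
        t≤d : t ≤ d
        t≤d = +-cancelʳ-≤ t t d (subst (_≤ d + t) (trans e n≡t+t) (subst (_≤ d + t) (+-comm d 1) (+-monoʳ-≤ d 1≤t)))
        d≮t : (d <ᵇ t) ≡ false
        d≮t = <ᵇ-false t≤d
        around-d≡1 : around d ≡ 1
        around-d≡1 = trans (cong (d ⊓_) (n∸d≡1 d e)) (m≥n⇒m⊓n≡n (≤-trans 1≤t t≤d))
    ... | inj₂ (_ , nd≡d+1) rewrite nd≡d+1 with d <? t
    ...   | yes d<t rewrite <ᵇ-true d<t
              | around-small d (subst (d + d ≤_) (sym n≡t+t) (+-mono-≤ (<⇒≤ d<t) (<⇒≤ d<t)))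
              | around-small (suc d) (subst (suc d + suc d ≤_) (sym n≡t+t) (+-mono-≤ d<t d<t))
              = <ᵇ-true (n<1+n d) , <ᵇ-false (n≤1+n d)
    ...   | no d≮t rewrite <ᵇ-false (≮⇒≥ d≮t)
              | around-large d (subst (_≤ d + d) (sym n≡t+t) (+-mono-≤ (≮⇒≥ d≮t) (≮⇒≥ d≮t)))
              | around-large (suc d) (subst (_≤ suc d + suc d) (sym n≡t+t) (+-mono-≤ (m≤n⇒m≤1+n (≮⇒≥ d≮t)) (m≤n⇒m≤1+n (≮⇒≥ d≮t))))
              | +-∸-assoc 1 d<n
              = <ᵇ-false (n≤1+n (n ∸ suc d)) , <ᵇ-true (n<1+n (n ∸ suc d))

    half-turn : ∀ m → ((m + t) % n <ᵇ t) ≡ not (m % n <ᵇ t)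
    half-turn m rewrite sym ([m%n+k]%n≡[m+k]%n m t) with m % n <? t
    ... | yes r<t rewrite <ᵇ-true r<t | m<n⇒m%n≡m (subst (m % n + t <_) (sym n≡t+t) (+-monoˡ-< t r<t)) =
      <ᵇ-false (m≤n+m t (m % n))
    ... | no r≮t rewrite <ᵇ-false (≮⇒≥ r≮t) = <ᵇ-true [r+t]%n<t
      where
        r : ℕ
        r = m % n
        t≤r : t ≤ r
        t≤r = ≮⇒≥ r≮t
        r+t≡r∸t+n : r + t ≡ (r ∸ t) + n
        r+t≡r∸t+n = trans (cong (_+ t) (sym (m∸n+n≡m t≤r))) (trans (+-assoc (r ∸ t) t t) (cong ((r ∸ t) +_) (sym n≡t+t)))
        r∸t<t : r ∸ t < t
        r∸t<t = +-cancelʳ-< t (r ∸ t) t (subst (_< t + t) (sym (m∸n+n≡m t≤r)) (subst (r <_) n≡t+t (m%n<n m n)))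
        [r+t]%n<t : (r + t) % n < t
        [r+t]%n<t = subst (_< t)
          (sym (trans (cong (_% n) r+t≡r∸t+n) (trans ([m+n]%n≡m%n (r ∸ t) n) (m<n⇒m%n≡m (≤-trans r∸t<t (subst (t ≤_) (sym n≡t+t) (m≤m+n t t)))))))
          r∸t<t

    n∸[t+m]≡t∸m : ∀ m → n ∸ (t + m) ≡ t ∸ m
    n∸[t+m]≡t∸m m = trans (cong (_∸ (t + m)) n≡t+t) ([m+n]∸[m+o]≡n∸o t t m)

    n∸m≡t+[t∸m] : ∀ m → m < t → n ∸ m ≡ t + (t ∸ m)
    n∸m≡t+[t∸m] m m<t = trans (cong (_∸ m) n≡t+t) (+-∸-assoc t (<⇒≤ m<t))

    -- Antipodal blocks lie on opposite sides of every cycle edge.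
    antipodal : ∀ m b → m < t → (offset (t + m) b <ᵇ t) ≡ not (offset m b <ᵇ t)
    antipodal m b m<t
      rewrite n∸[t+m]≡t∸m m | n∸m≡t+[t∸m] m m<t
            | solve 3 (λ a b c → a :+ (b :+ c) := (a :+ c) :+ b) refl b t (t ∸ m)
            | half-turn (b + (t ∸ m))
      = sym (not-involutive _)

  -- On an odd cycle n = t + t ∸ 1 the block at offset t ∸ 1 is equidistant from both ends of an edge.
  module OddCycle (t : ℕ) (n≡t+t∸1 : n ≡ t + t ∸ 1) (2≤t : 2 ≤ t) where

    tie : around (t ∸ 1) ≡ around (next (t ∸ 1))
    tie = tie-at t n≡t+t∸1 2≤t
      where
        tie-at : ∀ u → n ≡ u + u ∸ 1 → 2 ≤ u → around (u ∸ 1) ≡ around (next (u ∸ 1))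
        tie-at (suc (suc s)) e (s≤s (s≤s _)) with next-cases (suc s)
        ... | inj₁ (s+2≡n , _) = ⊥-elim (<⇒≢ (subst (suc (suc s) <_) (sym e) (s≤s (m≤n+m (suc (suc s)) s))) s+2≡n)
        ... | inj₂ (_ , ns≡s+1) rewrite ns≡s+1 =
          trans (cong (suc s ⊓_) n∸[s+1]≡s+2) (trans (m≤n⇒m⊓n≡m (n≤1+n (suc s)))
            (sym (trans (cong (suc (suc s) ⊓_) n∸[s+2]≡s+1) (m≥n⇒m⊓n≡n (n≤1+n (suc s))))))
          where
            n∸[s+1]≡s+2 : n ∸ suc s ≡ suc (suc s)
            n∸[s+1]≡s+2 = trans (cong (_∸ suc s) e) (m+n∸m≡n (suc s) (suc (suc s)))
            n∸[s+2]≡s+1 : n ∸ suc (suc s) ≡ suc s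
            n∸[s+2]≡s+1 = trans (cong (_∸ suc (suc s)) (trans e (+-comm (suc s) (suc (suc s))))) (m+n∸m≡n (suc (suc s)) (suc s))

-- The circuit: its adjacency and walks along the cycle

module Circuit (n : ℕ) (3≤n : 3 ≤ n) (G : Fin n → Graph) (simple : ∀ i → IsSimpleGraph (G i))
               (conn : ∀ i → Connected (G i)) (x : (i : Fin n) → Vertex (G i)) where

  instance
    n-nonZero : NonZero n
    n-nonZero = >-nonZero (≤-trans (s≤s z≤n) 3≤n)

  open Cyclic n public

  C : Graph
  C = circuit n G x

  V : Set
  V = Vertex C

  complete : ∀ k (v : Vertex (G k)) → v ∈ vertices (G k)
  complete k = IsSimpleGraph.complete (simple k)

  C-complete : ∀ v → v ∈ vertices C
  C-complete (i , a) =
    ∈-concat⁺′ (∈-map⁺ (i ,_) (complete i a)) (∈-map⁺ (λ j → map (j ,_) (vertices (G j))) (∈-allFin i))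

  module CW = Walks C C-complete
  module GW (k : Fin n) = Walks (G k) (complete k)

  adj-inner : ∀ k a b → adj C (k , a) (k , b) ≡ adj (G k) a b
  adj-inner k a b with k Fin.≟ k
  ... | yes refl = refl
  ... | no k≢k   = ⊥-elim (k≢k refl)

  adj-cross : ∀ k j a b → ¬ k ≡ j → adj C (k , a) (j , b) ≡ (cycAdj n k j ∧ (eqᵇ (G k) a (x k) ∧ eqᵇ (G j) b (x j)))
  adj-cross k j a b k≢j with k Fin.≟ j
  ... | yes k≡j = ⊥-elim (k≢j k≡j)
  ... | no _    = refl

  adj-sym : ∀ p q → adj C p q ≡ adj C q p
  adj-sym (k , a) (j , b) with k Fin.≟ j
  ... | yes refl = trans (IsSimpleGraph.adj-sym (simple k) a b) (sym (adj-inner k b a))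
  ... | no k≢j   = trans (cong₂ _∧_ (∨-comm (toℕ j ≡ᵇ nextℕ n k) (toℕ k ≡ᵇ nextℕ n j))
                                     (∧-comm (eqᵇ (G k) a (x k)) (eqᵇ (G j) b (x j))))
                         (sym (adj-cross j k b a (k≢j ∘ sym)))

  lift : ∀ k {a b} → Walk (G k) a b → Walk C (k , a) (k , b)
  lift k []      = []
  lift k (e ∷ w) = trans (adj-inner k _ _) e ∷ lift k w

  len-lift : ∀ k {a b} (w : Walk (G k) a b) → CW.len (lift k w) ≡ GW.len k w
  len-lift k []      = refl
  len-lift k (e ∷ w) = cong suc (len-lift k w)

  toℕ≤n : ∀ (j : Fin n) → toℕ j ≤ n
  toℕ≤n j = <⇒≤ (Finₚ.toℕ<n j)

  nextFin : Fin n → Fin n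
  nextFin j = fromℕ< (next<n (toℕ j) (Finₚ.toℕ<n j))

  toℕ-nextFin : ∀ j → toℕ (nextFin j) ≡ nextℕ n j
  toℕ-nextFin j = Finₚ.toℕ-fromℕ< (next<n (toℕ j) (Finₚ.toℕ<n j))

  -- This fails for n = 1, where the cycle edge would be a loop.
  nextFin≢ : ∀ j → ¬ nextFin j ≡ j
  nextFin≢ j e with next-cases (toℕ j)
  ... | inj₁ (j+1≡n , nj≡0) = 3≰1 (subst (3 ≤_) (trans (sym j+1≡n) (cong suc j≡0)) 3≤n)
    where
      j≡0 : toℕ j ≡ 0
      j≡0 = trans (sym (cong toℕ e)) (trans (toℕ-nextFin j) nj≡0)
      3≰1 : ¬ 3 ≤ 1
      3≰1 (s≤s ())
  ... | inj₂ (_ , nj≡j+1) = 1+n≢n (trans (sym nj≡j+1) (trans (sym (toℕ-nextFin j)) (cong toℕ e)))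

  hub-adj : ∀ j → adj C (j , x j) (nextFin j , x (nextFin j)) ≡ true
  hub-adj j rewrite adj-cross j (nextFin j) (x j) (x (nextFin j)) (nextFin≢ j ∘ sym)
                  | GW.eqᵇ-refl j (x j) | GW.eqᵇ-refl (nextFin j) (x (nextFin j))
                  | toℕ-nextFin j | ≡ᵇ-true {nextℕ n j} refl = refl

  advance : ℕ → Fin n → Fin n
  advance zero    j = j
  advance (suc m) j = nextFin (advance m j)

  hub-walk : ∀ m j → Σ (Walk C (j , x j) (advance m j , x (advance m j))) λ w → CW.len w ≡ m
  hub-walk zero    j = [] , refl
  hub-walk (suc m) j with hub-walk m j
  ... | w , w≡m = CW.snoc w (hub-adj (advance m j)) , trans (CW.len-snoc w _) (cong suc w≡m)

  offset-advance : ∀ m j → offset (toℕ j) (toℕ (advance m j)) ≡ m % n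
  offset-advance zero    j = trans (offset-refl (toℕ j) (toℕ≤n j)) (sym (m<n⇒m%n≡m (>-nonZero⁻¹ n)))
  offset-advance (suc m) j = begin
    offset (toℕ j) (toℕ (nextFin (advance m j))) ≡⟨ cong (offset (toℕ j)) (toℕ-nextFin (advance m j)) ⟩
    offset (toℕ j) (next (toℕ (advance m j)))    ≡⟨ offset-next (toℕ j) (toℕ (advance m j)) (Finₚ.toℕ<n (advance m j)) ⟩
    next (offset (toℕ j) (toℕ (advance m j)))    ≡⟨ cong next (offset-advance m j) ⟩
    next (m % n)                                 ≡⟨ next≡suc%n (m % n) (m%n<n m n) ⟩
    suc (m % n) % n                              ≡⟨ [m+k%n]%n≡[m+k]%n 1 m ⟩
    suc m % n                                    ∎ where open ≡-Reasoning

  advance-offset : ∀ k i → advance (offset (toℕ k) (toℕ i)) k ≡ i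
  advance-offset k i = Finₚ.toℕ-injective (offset-injective (toℕ k) (toℕ≤n k) (Finₚ.toℕ<n _) (Finₚ.toℕ<n i)
    (trans (offset-advance (offset (toℕ k) (toℕ i)) k) (m<n⇒m%n≡m (offset<n (toℕ k) (toℕ i)))))

  forward-walk : ∀ k i → Σ (Walk C (k , x k) (i , x i)) λ w → CW.len w ≡ offset (toℕ k) (toℕ i)
  forward-walk k i = subst (λ j → Σ (Walk C (k , x k) (j , x j)) λ w → CW.len w ≡ offset (toℕ k) (toℕ i))
                           (advance-offset k i) (hub-walk (offset (toℕ k) (toℕ i)) k)

  cyc : Fin n → Fin n → ℕ
  cyc k i = cycDist (toℕ k) (toℕ i)

  cyc-walk : ∀ k i → Σ (Walk C (k , x k) (i , x i)) λ w → CW.len w ≡ cyc k i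
  cyc-walk k i with offset (toℕ k) (toℕ i) ≤? n ∸ offset (toℕ k) (toℕ i)
  ... | yes d≤n∸d = let w , w≡d = forward-walk k i in w , trans w≡d (sym (m≤n⇒m⊓n≡m d≤n∸d))
  ... | no  d≰n∸d with forward-walk i k | offset+offset (toℕ k) (toℕ i) (toℕ≤n k) (toℕ≤n i)
  ...   | w , w≡d′ | inj₁ d+d′≡0 = ⊥-elim (d≰n∸d (subst (_≤ n ∸ offset (toℕ k) (toℕ i)) (sym (m+n≡0⇒m≡0 _ d+d′≡0)) z≤n))
  ...   | w , w≡d′ | inj₂ d+d′≡n = CW.reverse adj-sym w , (begin
      CW.len (CW.reverse adj-sym w) ≡⟨ CW.len-reverse adj-sym w ⟩
      CW.len w                      ≡⟨ w≡d′ ⟩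
      d′                            ≡⟨ m+n∸m≡n d d′ ⟨
      d + d′ ∸ d                    ≡⟨ cong (_∸ d) d+d′≡n ⟩
      n ∸ d                         ≡⟨ m≥n⇒m⊓n≡n (<⇒≤ (≰⇒> d≰n∸d)) ⟨
      cyc k i                       ∎)
    where
      open ≡-Reasoning
      d d′ : ℕ
      d  = offset (toℕ k) (toℕ i)
      d′ = offset (toℕ i) (toℕ k)

  cyc-refl : ∀ i → cyc i i ≡ 0
  cyc-refl i = cong around (offset-refl (toℕ i) (toℕ≤n i))

  cyc-sym : ∀ k i → cyc k i ≡ around (offset (toℕ i) (toℕ k))
  cyc-sym k i = cycDist-sym (toℕ k) (toℕ i) (toℕ≤n k) (toℕ≤n i)

  offsetTo : Fin n → Fin n → ℕ
  offsetTo i k = offset (toℕ k) (toℕ i)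

  cyc-succ : ∀ i j k → toℕ j ≡ nextℕ n i → cyc k j ≡ around (next (offsetTo i k))
  cyc-succ i j k j≡i+1 = cong around (trans (cong (offset (toℕ k)) j≡i+1) (offset-next (toℕ k) (toℕ i) (Finₚ.toℕ<n i)))

  cyc-adj≤ : ∀ k j i → cycAdj n k j ≡ true → cyc k i ≤ suc (cyc j i)
  cyc-adj≤ k j i e with ∨-true⁻ (toℕ j ≡ᵇ nextℕ n k) _ e
  ... | inj₁ j≡k+1 = subst₂ (λ u v → u ≤ suc v) (sym (cyc-sym k i))
                       (sym (trans (cyc-sym j i) (cyc-succ k j i (≡ᵇ-true⁻ _ _ j≡k+1))))
                       (around≤next _ (offset<n (toℕ i) (toℕ k)))
  ... | inj₂ k≡j+1 = subst₂ (λ u v → u ≤ suc v) (sym (trans (cyc-sym k i) (cyc-succ j k i (≡ᵇ-true⁻ _ _ k≡j+1))))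
                       (sym (cyc-sym j i))
                       (around-next≤ _ (offset<n (toℕ i) (toℕ j)))

  dec-⊎ : ∀ (k i : Fin n) → k ≡ i ⊎ ¬ k ≡ i
  dec-⊎ k i with k Fin.≟ i
  ... | yes k≡i = inj₁ k≡i
  ... | no  k≢i = inj₂ k≢i

  -- φ i a p is the distance from p to (i , a): a path between blocks passes through both hubs.
  φ : (i : Fin n) → Vertex (G i) → V → ℕ
  φ i a (k , c) with k Fin.≟ i
  ... | yes refl = dist (G i) c a
  ... | no  _    = dist (G k) c (x k) + cyc k i + dist (G i) (x i) a

  φ-inner : ∀ i a c → φ i a (i , c) ≡ dist (G i) c a
  φ-inner i a c with i Fin.≟ i
  ... | yes refl = refl
  ... | no  i≢i  = ⊥-elim (i≢i refl)

  φ-cross : ∀ i a k c → ¬ k ≡ i → φ i a (k , c) ≡ dist (G k) c (x k) + cyc k i + dist (G i) (x i) a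
  φ-cross i a k c k≢i with k Fin.≟ i
  ... | yes k≡i = ⊥-elim (k≢i k≡i)
  ... | no  _   = refl

  φ-inner-edge≤ : ∀ i a k c b → adj (G k) c b ≡ true → φ i a (k , c) ≤ suc (φ i a (k , b))
  φ-inner-edge≤ i a k c b e with dec-⊎ k i
  ... | inj₁ refl = subst₂ (λ u v → u ≤ suc v) (sym (φ-inner i a c)) (sym (φ-inner i a b))
                      (GW.dist-adj≤ i (conn i) c b a e)
  ... | inj₂ k≢i = subst₂ (λ u v → u ≤ suc v) (sym (φ-cross i a k c k≢i)) (sym (φ-cross i a k b k≢i))
                      (+-monoˡ-≤ (dist (G i) (x i) a) (+-monoˡ-≤ (cyc k i) (GW.dist-adj≤ k (conn k) c b (x k) e)))

  φ-hub : ∀ i a k → φ i a (k , x k) ≡ cyc k i + dist (G i) (x i) a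
  φ-hub i a k with dec-⊎ k i
  ... | inj₁ refl = trans (φ-inner i a (x i)) (cong (_+ dist (G i) (x i) a) (sym (cyc-refl i)))
  ... | inj₂ k≢i  = trans (φ-cross i a k (x k) k≢i) (cong (λ z → z + cyc k i + dist (G i) (x i) a) (GW.dist-refl k (x k)))

  φ-hub-edge≤ : ∀ i a k j → cycAdj n k j ≡ true → φ i a (k , x k) ≤ suc (φ i a (j , x j))
  φ-hub-edge≤ i a k j e rewrite φ-hub i a k | φ-hub i a j = +-monoˡ-≤ (dist (G i) (x i) a) (cyc-adj≤ k j i e)

  φ-adj≤ : ∀ i a p q → adj C p q ≡ true → φ i a p ≤ suc (φ i a q)
  φ-adj≤ i a (k , c) (j , b) e with dec-⊎ k j
  ... | inj₁ refl = φ-inner-edge≤ i a k c b (trans (sym (adj-inner k c b)) e)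
  ... | inj₂ k≢j with ∧-true⁻ (cycAdj n k j) _ (trans (sym (adj-cross k j c b k≢j)) e)
  ...   | k~j , hubs with ∧-true⁻ (eqᵇ (G k) c (x k)) _ hubs
  ...     | c≡xk , b≡xj with GW.eqᵇ⇒≡ k c (x k) c≡xk | GW.eqᵇ⇒≡ j b (x j) b≡xj
  ...       | refl | refl = φ-hub-edge≤ i a k j k~j

  φ-walk : ∀ i a p → Σ (Walk C p (i , a)) λ w → CW.len w ≡ φ i a p
  φ-walk i a (k , c) with dec-⊎ k i
  ... | inj₁ refl = let w , w≡d = GW.geodesic i (conn i c a) in
                    lift i w , trans (len-lift i w) (trans w≡d (sym (φ-inner i a c)))
  ... | inj₂ k≢i with GW.geodesic k (conn k c (x k)) | cyc-walk k i | GW.geodesic i (conn i (x i) a)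
  ...   | w₁ , w₁≡ | w₂ , w₂≡ | w₃ , w₃≡ = lift k w₁ CW.++ʷ w₂ CW.++ʷ lift i w₃ , (begin
      CW.len (lift k w₁ CW.++ʷ w₂ CW.++ʷ lift i w₃)                 ≡⟨ CW.len-++ʷ (lift k w₁) _ ⟩
      CW.len (lift k w₁) + CW.len (w₂ CW.++ʷ lift i w₃)            ≡⟨ cong (CW.len (lift k w₁) +_) (CW.len-++ʷ w₂ (lift i w₃)) ⟩
      CW.len (lift k w₁) + (CW.len w₂ + CW.len (lift i w₃))        ≡⟨ cong₂ (λ u v → u + (CW.len w₂ + v)) (len-lift k w₁) (len-lift i w₃) ⟩
      GW.len k w₁ + (CW.len w₂ + GW.len i w₃)                      ≡⟨ cong₂ (λ u v → u + v) w₁≡ (cong₂ _+_ w₂≡ w₃≡) ⟩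
      dist (G k) c (x k) + (cyc k i + dist (G i) (x i) a)          ≡⟨ +-assoc (dist (G k) c (x k)) _ _ ⟨
      dist (G k) c (x k) + cyc k i + dist (G i) (x i) a            ≡⟨ φ-cross i a k c k≢i ⟨
      φ i a (k , c)                                                ∎)
    where open ≡-Reasoning

  dist-circuit : ∀ i a p → dist C p (i , a) ≡ φ i a p
  dist-circuit i a p with φ-walk i a p
  ... | w , w≡φ = CW.dist≡ w (φ i a p) w≡φ (λ w′ → subst (φ i a p ≤_) (len+φ-target w′) (CW.potential≤len (φ i a) (φ-adj≤ i a) w′))
    where
      len+φ-target : ∀ (w′ : Walk C p (i , a)) → CW.len w′ + φ i a (i , a) ≡ CW.len w′
      len+φ-target w′ = trans (cong (CW.len w′ +_) (trans (φ-inner i a a) (GW.dist-refl i a))) (+-identityʳ _)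

  dist-inner : ∀ i c a → dist C (i , c) (i , a) ≡ dist (G i) c a
  dist-inner i c a = trans (dist-circuit i a (i , c)) (φ-inner i a c)

  dist-to-hub : ∀ k c i → dist C (k , c) (i , x i) ≡ dist (G k) c (x k) + cyc k i
  dist-to-hub k c i with dec-⊎ k i
  ... | inj₁ refl = trans (dist-inner k c (x k)) (sym (trans (cong (dist (G k) c (x k) +_) (cyc-refl k)) (+-identityʳ _)))
  ... | inj₂ k≢i  = trans (dist-circuit i (x i) (k , c))
                      (trans (φ-cross i (x i) k c k≢i) (trans (cong (dist (G k) c (x k) + cyc k i +_) (GW.dist-refl i (x i))) (+-identityʳ _)))

  size : Fin n → ℕ
  size k = ∣V∣ (G k)

  N : ℕ
  N = ∣V∣ C

  sumOf-C : ∀ (g : V → ℕ) → sumOf g (vertices C) ≡ ΣFin n (λ k → sumOf (λ c → g (k , c)) (vertices (G k)))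
  sumOf-C g = sumOf-blocks g (vertices ∘ G) (allFin n)

  N≡Σsize : N ≡ ΣFin n size
  N≡Σsize = trans (length≡sumOf (vertices C)) (trans (sumOf-C (λ _ → 1)) (ΣFin-cong n (λ k → sym (length≡sumOf (vertices (G k))))))

  closerIn : V → V → Fin n → ℕ
  closerIn u v k = sumOf (λ c → indicator (dist C (k , c) u <ᵇ dist C (k , c) v) 1) (vertices (G k))

  nClose≡ΣcloserIn : ∀ u v → nClose C u v ≡ ΣFin n (closerIn u v)
  nClose≡ΣcloserIn u v = trans (length-filterᵇ _ (vertices C)) (sumOf-C _)

  closerIn≤size : ∀ u v k → closerIn u v k ≤ size k
  closerIn≤size u v k = ≤-trans (sumOf-mono (vertices (G k)) (λ c → indicator≤ _ 1)) (≤-reflexive (sym (length≡sumOf (vertices (G k)))))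

  others : Fin n → (Fin n → ℕ) → ℕ
  others i f = ΣFin n (λ k → if does (k Fin.≟ i) then 0 else f k)

  others-size : ∀ i → others i size ≡ N ∸ size i
  others-size i = sym (trans (cong (_∸ size i) (trans N≡Σsize (ΣFin-split n size i))) (m+n∸m≡n (size i) (others i size)))

  others-mono : ∀ i {f g} → (∀ k → f k ≤ g k) → others i f ≤ others i g
  others-mono i f≤g = ΣFin-mono n (λ k → if0-mono (does (k Fin.≟ i)) (f≤g k))
    where
      if0-mono : ∀ b {p q} → p ≤ q → (if b then 0 else p) ≤ (if b then 0 else q)
      if0-mono true  _   = z≤n
      if0-mono false p≤q = p≤q

  nClose-inner : ∀ i a b → nClose C (i , a) (i , b) ≡ nClose (G i) a b + others i (closerIn (i , a) (i , b))
  nClose-inner i a b = begin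
      nClose C (i , a) (i , b)                                            ≡⟨ nClose≡ΣcloserIn _ _ ⟩
      ΣFin n (closerIn (i , a) (i , b))                                   ≡⟨ ΣFin-split n (closerIn (i , a) (i , b)) i ⟩
      closerIn (i , a) (i , b) i + others i (closerIn (i , a) (i , b))    ≡⟨ cong (_+ others i (closerIn (i , a) (i , b))) own-block ⟩
      nClose (G i) a b + others i (closerIn (i , a) (i , b))              ∎
    where
      open ≡-Reasoning
      own-block : closerIn (i , a) (i , b) i ≡ nClose (G i) a b
      own-block = trans (sumOf-cong {g = λ c → indicator (dist (G i) c a <ᵇ dist (G i) c b) 1} (vertices (G i))
                                    (λ c → cong₂ (λ p q → indicator (p <ᵇ q) 1) (dist-inner i c a) (dist-inner i c b)))
                        (sym (length-filterᵇ _ (vertices (G i))))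

  inner-edge-bound : ∀ i a b →
    ∣ nClose C (i , a) (i , b) - nClose C (i , b) (i , a) ∣ ≤ ∣ nClose (G i) a b - nClose (G i) b a ∣ + (N ∸ size i)
  inner-edge-bound i a b rewrite nClose-inner i a b | nClose-inner i b a = ≤-trans
    (∣m+n-o+p∣≤∣m-o∣+∣n-p∣ (nClose (G i) a b) (others i (closerIn (i , a) (i , b))) (nClose (G i) b a) (others i (closerIn (i , b) (i , a))))
    (+-monoʳ-≤ _ (subst (∣ others i (closerIn (i , a) (i , b)) - others i (closerIn (i , b) (i , a)) ∣ ≤_) (others-size i)
      (∣m-n∣≤o (others-mono i (closerIn≤size _ _)) (others-mono i (closerIn≤size _ _)))))

  closerIn-hubs : ∀ i j k → closerIn (i , x i) (j , x j) k ≡ indicator (cyc k i <ᵇ cyc k j) (size k)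
  closerIn-hubs i j k = begin
      closerIn (i , x i) (j , x j) k
    ≡⟨ sumOf-cong (vertices (G k)) (λ c → cong (λ b → indicator b 1) (trans
         (cong₂ _<ᵇ_ (dist-to-hub k c i) (dist-to-hub k c j)) (+-<ᵇ-cancelˡ (dist (G k) c (x k)) (cyc k i) (cyc k j)))) ⟩
      sumOf (λ _ → indicator (cyc k i <ᵇ cyc k j) 1) (vertices (G k))
    ≡⟨ sumOf-indicator (cyc k i <ᵇ cyc k j) (λ _ → 1) (vertices (G k)) ⟩
      indicator (cyc k i <ᵇ cyc k j) (sumOf (λ _ → 1) (vertices (G k)))
    ≡⟨ cong (indicator (cyc k i <ᵇ cyc k j)) (length≡sumOf (vertices (G k))) ⟨
      indicator (cyc k i <ᵇ cyc k j) (size k)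
    ∎ where open ≡-Reasoning

  nClose-cycle-edge : ∀ i j → toℕ j ≡ nextℕ n i →
    nClose C (i , x i) (j , x j) ≡ ΣFin n (λ k → indicator (around (offsetTo i k) <ᵇ around (next (offsetTo i k))) (size k))
  nClose-cycle-edge i j j≡i+1 = trans (nClose≡ΣcloserIn _ _) (ΣFin-cong n (λ k → trans (closerIn-hubs i j k)
    (cong (λ z → indicator (around (offsetTo i k) <ᵇ z) (size k)) (cyc-succ i j k j≡i+1))))

  nClose-cycle-edge′ : ∀ i j → toℕ j ≡ nextℕ n i →
    nClose C (j , x j) (i , x i) ≡ ΣFin n (λ k → indicator (around (next (offsetTo i k)) <ᵇ around (offsetTo i k)) (size k))
  nClose-cycle-edge′ i j j≡i+1 = trans (nClose≡ΣcloserIn _ _) (ΣFin-cong n (λ k → trans (closerIn-hubs j i k)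
    (cong (λ z → indicator (z <ᵇ around (offsetTo i k)) (size k)) (cyc-succ i j k j≡i+1))))

  -- Splitting the Mostar index of the circuit into block edges and cycle edges

  edgeTerm : V × V → ℕ
  edgeTerm (p , q) = indicator (adj C p q) ∣ nClose C p q - nClose C q p ∣

  sameBlock : V × V → Bool
  sameBlock ((i , _) , (j , _)) = does (i Fin.≟ j)

  innerTerm crossTerm : V × V → ℕ
  innerTerm e = if sameBlock e then edgeTerm e else 0
  crossTerm e = if sameBlock e then 0 else edgeTerm e

  Mo-C≡ : Mo C ≡ sumOf innerTerm (pairs (vertices C)) + sumOf crossTerm (pairs (vertices C))
  Mo-C≡ = trans (sumOf-filterᵇ (λ e → adj C (proj₁ e) (proj₂ e)) _ (pairs (vertices C)))
                (trans (sumOf-cong (pairs (vertices C)) split) (sumOf-+ innerTerm crossTerm (pairs (vertices C))))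
    where
      split : ∀ e → edgeTerm e ≡ innerTerm e + crossTerm e
      split e with sameBlock e
      ... | true  = sym (+-identityʳ _)
      ... | false = refl

  sameBlock-refl : ∀ i (a b : Vertex (G i)) → sameBlock ((i , a) , (i , b)) ≡ true
  sameBlock-refl i a b with i Fin.≟ i
  ... | yes _   = refl
  ... | no  i≢i = ⊥-elim (i≢i refl)

  sameBlock-≢ : ∀ {i j} (a : Vertex (G i)) (b : Vertex (G j)) → ¬ i ≡ j → sameBlock ((i , a) , (j , b)) ≡ false
  sameBlock-≢ {i} {j} a b i≢j with i Fin.≟ j
  ... | yes i≡j = ⊥-elim (i≢j i≡j)
  ... | no  _   = refl

  innerTerm-bound : ∀ i a b →
    innerTerm ((i , a) , (i , b)) ≤ indicator (adj (G i) a b) ∣ nClose (G i) a b - nClose (G i) b a ∣ + indicator (adj (G i) a b) (N ∸ size i)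
  innerTerm-bound i a b rewrite sameBlock-refl i a b | adj-inner i a b with adj (G i) a b
  ... | true  = inner-edge-bound i a b
  ... | false = z≤n

  inner-sum-bound : sumOf innerTerm (pairs (vertices C)) ≤ ΣFin n (λ i → Mo (G i) + ∣E∣ (G i) * (N ∸ size i))
  inner-sum-bound = begin
      sumOf innerTerm (pairs (vertices C))
    ≡⟨ sumOf-pairs-blocks innerTerm (vertices ∘ G) (allFin n) (allFin⁺ n) vanish ⟩
      ΣFin n (λ i → sumOf (λ p → innerTerm ((i , proj₁ p) , (i , proj₂ p))) (pairs (vertices (G i))))
    ≤⟨ ΣFin-mono n (λ i → ≤-trans (sumOf-mono (pairs (vertices (G i))) (λ p → innerTerm-bound i (proj₁ p) (proj₂ p)))
                                   (≤-reflexive (per-block i))) ⟩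
      ΣFin n (λ i → Mo (G i) + ∣E∣ (G i) * (N ∸ size i))
    ∎
    where
      open ≤-Reasoning
      vanish : ∀ {i j} a b → ¬ i ≡ j → innerTerm ((i , a) , (j , b)) ≡ 0
      vanish a b i≢j rewrite sameBlock-≢ a b i≢j = refl
      per-block : ∀ i → sumOf (λ p → indicator (adj (G i) (proj₁ p) (proj₂ p)) ∣ nClose (G i) (proj₁ p) (proj₂ p) - nClose (G i) (proj₂ p) (proj₁ p) ∣
                                    + indicator (adj (G i) (proj₁ p) (proj₂ p)) (N ∸ size i)) (pairs (vertices (G i)))
                        ≡ Mo (G i) + ∣E∣ (G i) * (N ∸ size i)
      per-block i = trans (sumOf-+ _ _ (pairs (vertices (G i))))
        (cong₂ _+_ (sym (sumOf-filterᵇ (λ e → adj (G i) (proj₁ e) (proj₂ e)) _ (pairs (vertices (G i)))))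
                   (sumOf-indicator-const (λ e → adj (G i) (proj₁ e) (proj₂ e)) (N ∸ size i) (pairs (vertices (G i)))))

  -- Charging each cycle edge c_i c_{i+1} to B i
  module CycleEdges (B : Fin n → ℕ)
    (cycle-edge≤ : ∀ i j → toℕ j ≡ nextℕ n i → ∣ nClose C (i , x i) (j , x j) - nClose C (j , x j) (i , x i) ∣ ≤ B i) where

    hubTerm : V → V → ℕ
    hubTerm (i , a) (j , b) = indicator (eqᵇ (G i) a (x i)) (indicator (toℕ j ≡ᵇ nextℕ n i) (indicator (eqᵇ (G j) b (x j)) (B i)))

    crossTerm≤ : ∀ p q → crossTerm (p , q) ≤ hubTerm p q + hubTerm q p
    crossTerm≤ (i , a) (j , b) with dec-⊎ i j
    ... | inj₁ refl rewrite sameBlock-refl i a b = z≤n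
    ... | inj₂ i≢j rewrite sameBlock-≢ a b i≢j with adj C (i , a) (j , b) in e
    ...   | false = z≤n
    ...   | true with ∧-true⁻ (cycAdj n i j) _ (trans (sym (adj-cross i j a b i≢j)) e)
    ...     | i~j , hubs with ∧-true⁻ (eqᵇ (G i) a (x i)) _ hubs
    ...       | a≡xi , b≡xj with GW.eqᵇ⇒≡ i a (x i) a≡xi | GW.eqᵇ⇒≡ j b (x j) b≡xj
    ...         | refl | refl rewrite GW.eqᵇ-refl i (x i) | GW.eqᵇ-refl j (x j) with ∨-true⁻ (toℕ j ≡ᵇ nextℕ n i) _ i~j
    ...           | inj₁ j≡i+1 rewrite j≡i+1 = ≤-trans (cycle-edge≤ i j (≡ᵇ-true⁻ _ _ j≡i+1)) (m≤m+n (B i) _)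
    ...           | inj₂ i≡j+1 rewrite i≡j+1 = ≤-trans
        (subst (_≤ B j) (∣-∣-comm (nClose C (j , x j) (i , x i)) _) (cycle-edge≤ j i (≡ᵇ-true⁻ _ _ i≡j+1)))
        (m≤n+m (B j) _)

    -- Each block has one hub, and each hub one successor on the cycle.
    hubTerm-row : ∀ i a → sumOf (hubTerm (i , a)) (vertices C) ≤ indicator (eqᵇ (G i) a (x i)) (B i)
    hubTerm-row i a = begin
        sumOf (hubTerm (i , a)) (vertices C)
      ≡⟨ sumOf-C (hubTerm (i , a)) ⟩
        ΣFin n (λ j → sumOf (λ b → hubTerm (i , a) (j , b)) (vertices (G j)))
      ≤⟨ ΣFin-mono n (λ j → ≤-reflexive (trans
           (sumOf-indicator (eqᵇ (G i) a (x i)) _ (vertices (G j)))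
           (cong (indicator (eqᵇ (G i) a (x i))) (sumOf-indicator (toℕ j ≡ᵇ nextℕ n i) _ (vertices (G j)))))) ⟩
        ΣFin n (λ j → indicator (eqᵇ (G i) a (x i)) (indicator (toℕ j ≡ᵇ nextℕ n i) (sumOf (λ b → indicator (eqᵇ (G j) b (x j)) (B i)) (vertices (G j)))))
      ≤⟨ ΣFin-mono n (λ j → indicator-mono (eqᵇ (G i) a (x i)) (indicator-mono (toℕ j ≡ᵇ nextℕ n i)
           (sumOf-single≤ (_≟_ (G j)) (x j) (B i) (vertices (G j)) (IsSimpleGraph.unique (simple j))))) ⟩
        ΣFin n (λ j → indicator (eqᵇ (G i) a (x i)) (indicator (toℕ j ≡ᵇ nextℕ n i) (B i)))
      ≡⟨ sumOf-indicator (eqᵇ (G i) a (x i)) _ (allFin n) ⟩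
        indicator (eqᵇ (G i) a (x i)) (ΣFin n (λ j → indicator (toℕ j ≡ᵇ nextℕ n i) (B i)))
      ≤⟨ indicator-mono (eqᵇ (G i) a (x i)) (ΣFin-indicator≤ n (nextℕ n i) (B i)) ⟩
        indicator (eqᵇ (G i) a (x i)) (B i)
      ∎ where open ≤-Reasoning

    hubTerm-sum : sumOf (λ p → sumOf (hubTerm p) (vertices C)) (vertices C) ≤ ΣFin n B
    hubTerm-sum = begin
        sumOf (λ p → sumOf (hubTerm p) (vertices C)) (vertices C)
      ≡⟨ sumOf-C _ ⟩
        ΣFin n (λ i → sumOf (λ a → sumOf (hubTerm (i , a)) (vertices C)) (vertices (G i)))
      ≤⟨ ΣFin-mono n (λ i → ≤-trans (sumOf-mono (vertices (G i)) (hubTerm-row i))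
           (sumOf-single≤ (_≟_ (G i)) (x i) (B i) (vertices (G i)) (IsSimpleGraph.unique (simple i)))) ⟩
        ΣFin n B
      ∎ where open ≤-Reasoning

    cross-sum-bound : sumOf crossTerm (pairs (vertices C)) ≤ ΣFin n B
    cross-sum-bound = ≤-trans (sumOf-mono (pairs (vertices C)) (λ e → crossTerm≤ (proj₁ e) (proj₂ e)))
                              (≤-trans (sumOf-pairs-sym≤ hubTerm (vertices C)) hubTerm-sum)

    Mo-bound : Mo C ≤ ΣFin n (λ i → Mo (G i)) + ΣFin n (λ i → ∣E∣ (G i) * (N ∸ size i)) + ΣFin n B
    Mo-bound = begin
        Mo C
      ≡⟨ Mo-C≡ ⟩
        sumOf innerTerm (pairs (vertices C)) + sumOf crossTerm (pairs (vertices C))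
      ≤⟨ +-mono-≤ inner-sum-bound cross-sum-bound ⟩
        ΣFin n (λ i → Mo (G i) + ∣E∣ (G i) * (N ∸ size i)) + ΣFin n B
      ≡⟨ cong (_+ ΣFin n B) (ΣFin-+ n (λ i → Mo (G i)) (λ i → ∣E∣ (G i) * (N ∸ size i))) ⟩
        ΣFin n (λ i → Mo (G i)) + ΣFin n (λ i → ∣E∣ (G i) * (N ∸ size i)) + ΣFin n B
      ∎ where open ≤-Reasoning

  sizeAt-toℕ : ∀ k → sizeAt n G (toℕ k) ≡ size k
  sizeAt-toℕ k with toℕ k <? n
  ... | yes k<n = cong (∣V∣ ∘ G) (Finₚ.fromℕ<-toℕ k k<n)
  ... | no  k≮n = ⊥-elim (k≮n (Finₚ.toℕ<n k))

  module EvenBound (t : ℕ) (n≡2t : n ≡ 2 * t) where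

    n≡t+t : n ≡ t + t
    n≡t+t = trans n≡2t (cong (t +_) (+-identityʳ t))

    open EvenCycle t n≡t+t

    sz : ℕ → ℕ
    sz = sizeAt n G

    -- Whether block m lies on the side of c_i of the edge c_i c_{i+1}.
    onSide : Fin n → ℕ → Bool
    onSide i m = offset m (toℕ i) <ᵇ t

    near far : Fin n → ℕ → ℕ
    near i m = indicator (onSide i m) (sz m)
    far  i m = indicator (not (onSide i m)) (sz m)

    Σ<-halves : ∀ (f : ℕ → ℕ) → Σ< n f ≡ Σ< t (λ m → f m + f (t + m))
    Σ<-halves f = trans (cong (λ u → Σ< u f) n≡t+t) (trans (Σ<-+-split t t f) (sym (Σ<-+ t f (λ m → f (t + m)))))

    nClose-even : ∀ i j → toℕ j ≡ nextℕ n i →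
      nClose C (i , x i) (j , x j) ≡ Σ< n (near i) × nClose C (j , x j) (i , x i) ≡ Σ< n (far i)
    nClose-even i j j≡i+1 =
      trans (nClose-cycle-edge i j j≡i+1)
            (trans (ΣFin-cong n (λ k → cong₂ indicator (proj₁ (around-next-comparison (offsetTo i k) (offset<n (toℕ k) (toℕ i)))) (sym (sizeAt-toℕ k))))
                   (ΣFin-toℕ n (near i))) ,
      trans (nClose-cycle-edge′ i j j≡i+1)
            (trans (ΣFin-cong n (λ k → cong₂ indicator (proj₂ (around-next-comparison (offsetTo i k) (offset<n (toℕ k) (toℕ i)))) (sym (sizeAt-toℕ k))))
                   (ΣFin-toℕ n (far i)))

    antipodal-pair : ∀ b u v → ∣ indicator b u + indicator (not b) v - (indicator (not b) u + indicator (not (not b)) v) ∣ ≡ ∣ u - v ∣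
    antipodal-pair true  u v = cong₂ ∣_-_∣ (+-identityʳ u) refl
    antipodal-pair false u v = trans (cong (∣ v -_∣) (+-identityʳ u)) (∣-∣-comm v u)

    gap : ℕ
    gap = Σ< t (λ m → ∣ sz m - sz (t + m) ∣)

    antipodal-gap : ∀ i m → m < t → ∣ near i m + near i (t + m) - (far i m + far i (t + m)) ∣ ≡ ∣ sz m - sz (t + m) ∣
    antipodal-gap i m m<t rewrite antipodal m (toℕ i) m<t = antipodal-pair (onSide i m) (sz m) (sz (t + m))

    cycle-edge≤ : ∀ i j → toℕ j ≡ nextℕ n i → ∣ nClose C (i , x i) (j , x j) - nClose C (j , x j) (i , x i) ∣ ≤ gap
    cycle-edge≤ i j j≡i+1 rewrite proj₁ (nClose-even i j j≡i+1) | proj₂ (nClose-even i j j≡i+1)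
                                | Σ<-halves (near i) | Σ<-halves (far i) =
      ≤-trans (Σ<-∣-∣ t _ _) (≤-reflexive (Σ<-cong t (antipodal-gap i)))

    Mo-circuit≤ : Mo C ≤ ΣFin n (λ i → Mo (G i)) + ΣFin n (λ i → ∣E∣ (G i) * (N ∸ size i)) + n * gap
    Mo-circuit≤ = ≤-trans (CycleEdges.Mo-bound (λ _ → gap) cycle-edge≤) (≤-reflexive (cong (_ +_) (ΣFin-const n gap)))

  -- An edge never separates the tied block, which contributes to neither side.
  indicator-trichotomy : ∀ a b tie m → (tie ≡ true → a ≡ b) →
    indicator (a <ᵇ b) m + indicator (b <ᵇ a) m + indicator tie m ≤ m
  indicator-trichotomy a b true  m a≡b rewrite a≡b refl | <ᵇ-false (≤-refl {b}) = ≤-refl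
  indicator-trichotomy a b false m _ with a <? b
  ... | yes a<b rewrite <ᵇ-true a<b | <ᵇ-false (<⇒≤ a<b) = ≤-reflexive (trans (+-identityʳ _) (+-identityʳ m))
  ... | no  a≮b rewrite <ᵇ-false (≮⇒≥ a≮b) = ≤-trans (≤-reflexive (+-identityʳ _)) (indicator≤ (b <ᵇ a) m)

  module OddBound (t : ℕ) (n≡2t∸1 : n ≡ 2 * t ∸ 1) where

    n≡t+t∸1 : n ≡ t + t ∸ 1
    n≡t+t∸1 = trans n≡2t∸1 (cong (λ u → t + u ∸ 1) (+-identityʳ t))

    2≤t : 2 ≤ t
    2≤t = two≤ t n≡t+t∸1
      where
        two≤ : ∀ u → n ≡ u + u ∸ 1 → 2 ≤ u
        two≤ zero          n≡0 = ⊥-elim (≤⇒≯ (subst (3 ≤_) n≡0 3≤n) (s≤s z≤n))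
        two≤ (suc zero)    n≡1 = ⊥-elim (≤⇒≯ (subst (3 ≤_) n≡1 3≤n) (s≤s (s≤s z≤n)))
        two≤ (suc (suc _)) _   = s≤s (s≤s z≤n)

    open OddCycle t n≡t+t∸1 2≤t

    tied : Fin n → ℕ
    tied i = ΣFin n (λ k → indicator (offsetTo i k ≡ᵇ (t ∸ 1)) (size k))

    tied≤N : ∀ i → tied i ≤ N
    tied≤N i = subst (tied i ≤_) (sym N≡Σsize) (ΣFin-mono n (λ k → indicator≤ _ (size k)))

    cycle-edge≤ : ∀ i j → toℕ j ≡ nextℕ n i → ∣ nClose C (i , x i) (j , x j) - nClose C (j , x j) (i , x i) ∣ ≤ N ∸ tied i
    cycle-edge≤ i j j≡i+1 = ≤-trans (∣m-n∣≤m+n (nClose C (i , x i) (j , x j)) (nClose C (j , x j) (i , x i)))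
                                    (m+n≤o⇒m≤o∸n (nClose C (i , x i) (j , x j) + nClose C (j , x j) (i , x i)) (begin
        nClose C (i , x i) (j , x j) + nClose C (j , x j) (i , x i) + tied i
      ≡⟨ cong₂ (λ u v → u + v + tied i) (nClose-cycle-edge i j j≡i+1) (nClose-cycle-edge′ i j j≡i+1) ⟩
        ΣFin n closer + ΣFin n farther + tied i
      ≡⟨ cong (_+ tied i) (ΣFin-+ n closer farther) ⟨
        ΣFin n (λ k → closer k + farther k) + tied i
      ≡⟨ ΣFin-+ n (λ k → closer k + farther k) _ ⟨
        ΣFin n (λ k → closer k + farther k + indicator (offsetTo i k ≡ᵇ (t ∸ 1)) (size k))
      ≤⟨ ΣFin-mono n (λ k → indicator-trichotomy (around (offsetTo i k)) (around (next (offsetTo i k))) _ (size k)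
                              (λ e → subst (λ d → around d ≡ around (next d)) (sym (≡ᵇ-true⁻ _ _ e)) tie)) ⟩
        ΣFin n size
      ≡⟨ N≡Σsize ⟨
        N
      ∎))
      where
        open ≤-Reasoning
        closer farther : Fin n → ℕ
        closer  k = indicator (around (offsetTo i k) <ᵇ around (next (offsetTo i k))) (size k)
        farther k = indicator (around (next (offsetTo i k)) <ᵇ around (offsetTo i k)) (size k)

    t∸1<n : t ∸ 1 < n
    t∸1<n = subst (t ∸ 1 <_) (sym n≡t+t∸1) (∸-monoˡ-< (m<m+n t (≤-trans (s≤s z≤n) 2≤t)) (≤-trans (s≤s z≤n) 2≤t))

    -- Every block is the tied block of exactly the edge opposite to it.
    N≤Σtied : N ≤ ΣFin n tied
    N≤Σtied = subst₂ _≤_ (sym N≡Σsize) (sym (ΣFin-swap n n (λ i k → indicator (offsetTo i k ≡ᵇ (t ∸ 1)) (size k))))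
      (ΣFin-mono n (λ k → ≤-trans (≤-reflexive (cong (λ b → indicator b (size k)) (sym (≡ᵇ-true (opposite k)))))
                                  (ΣFin-single n (λ i → indicator (offsetTo i k ≡ᵇ (t ∸ 1)) (size k)) (advance (t ∸ 1) k))))
      where
        opposite : ∀ k → offsetTo (advance (t ∸ 1) k) k ≡ t ∸ 1
        opposite k = trans (offset-advance (t ∸ 1) k) (m<n⇒m%n≡m t∸1<n)

    Σbound : ΣFin n (λ i → N ∸ tied i) ≤ (n ∸ 1) * N
    Σbound = begin
        ΣFin n (λ i → N ∸ tied i)
      ≡⟨ m+n∸n≡m _ (ΣFin n tied) ⟨
        ΣFin n (λ i → N ∸ tied i) + ΣFin n tied ∸ ΣFin n tied
      ≡⟨ cong (_∸ ΣFin n tied) (ΣFin-+ n (λ i → N ∸ tied i) tied) ⟨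
        ΣFin n (λ i → N ∸ tied i + tied i) ∸ ΣFin n tied
      ≡⟨ cong (_∸ ΣFin n tied) (trans (ΣFin-cong n (λ i → m∸n+n≡m (tied≤N i))) (ΣFin-const n N)) ⟩
        n * N ∸ ΣFin n tied
      ≤⟨ ∸-monoʳ-≤ (n * N) N≤Σtied ⟩
        n * N ∸ N
      ≡⟨ cong (n * N ∸_) (*-identityˡ N) ⟨
        n * N ∸ 1 * N
      ≡⟨ *-distribʳ-∸ N n 1 ⟨
        (n ∸ 1) * N
      ∎ where open ≤-Reasoning

    Mo-circuit≤ : Mo C ≤ ΣFin n (λ i → Mo (G i)) + ΣFin n (λ i → ∣E∣ (G i) * (N ∸ size i)) + (n ∸ 1) * N
    Mo-circuit≤ = ≤-trans (CycleEdges.Mo-bound (λ i → N ∸ tied i) cycle-edge≤) (+-monoʳ-≤ _ Σbound)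

mainTheorem6 : (n : ℕ) → 3 ≤ n →
    (G : Fin n → Graph) → (∀ i → IsSimpleGraph (G i)) → (∀ i → Connected (G i)) →
    (x : (i : Fin n) → Vertex (G i)) →
    ((t : ℕ) → n ≡ 2 * t →
       Mo (circuit n G x) ≤
         ΣFin n (λ i → Mo (G i))
         + ΣFin n (λ i → ∣E∣ (G i) * (∣V∣ (circuit n G x) ∸ ∣V∣ (G i)))
         + n * Σ< t (λ i → ∣ sizeAt n G i - sizeAt n G (t + i) ∣))
    ×
    ((t : ℕ) → n ≡ 2 * t ∸ 1 →
       Mo (circuit n G x) ≤
         ΣFin n (λ i → Mo (G i))
         + ΣFin n (λ i → ∣E∣ (G i) * (∣V∣ (circuit n G x) ∸ ∣V∣ (G i)))
         + (n ∸ 1) * ∣V∣ (circuit n G x))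
mainTheorem6 n 3≤n G simple conn x = EvenBound.Mo-circuit≤ , OddBound.Mo-circuit≤
  where open Circuit n 3≤n G simple conn x
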